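{- If $f:\{0,1\}^n\to\{0,1\}$ is a monotone Boolean function, then \[ \max\{\mathsf{N}(f)^2,\mathsf{N}(\overline f)^2\}\ge\Omega(s(f)). \]
   Context: $\mathsf{N}(f)$ is the minimum degree of a real polynomial $p$ with $|p(x)|\le 1/3$ whenever $f(x)=0$ and $|p(x)|\ge 1$ whenever $f(x)=1$; $\overline f=1-f$. $s(f)$ is the sensitivity of $f$: the maximum over $x$ of the number of $i\in[n]$ such that flipping bit $i$ of $x$ changes $f$. Monotone means non-decreasing or non-increasing in the coordinatewise order. The $\Omega(\cdot)$ hides an absolute positive constant.
   Formalization: The polynomials in the definitions of $\mathsf{N}(f)$ and $\mathsf{N}(\overline f)$ have rational coefficients instead of real ones. -}

module Defs where

open import Data.Bool using (Bool; true; false; not; if_then_else_)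
import Data.Bool as B
open import Data.Nat as ℕ using (ℕ; zero; suc; _⊔_)
open import Data.Fin using (Fin; zero; suc)
import Data.Fin as F
open import Data.List using (List; []; _∷_; map; foldr; length; _++_; allFin)
open import Data.Product using (_×_; _,_; ∃; Σ)
open import Data.Sum using (_⊎_)
open import Data.Integer using (+_)
open import Data.Rational using (ℚ; 0ℚ; 1ℚ; _+_; _*_; _≤_; ∣_∣; _/_)
open import Relation.Nullary using (yes; no)

BoolFun : ℕ → Set
BoolFun n = (Fin n → Bool) → Bool

compl : ∀ {n} → BoolFun n → BoolFun n
compl f x = not (f x)

_≤ᶜ_ : ∀ {n} → (Fin n → Bool) → (Fin n → Bool) → Set
x ≤ᶜ y = ∀ i → x i B.≤ y i

NonDecreasing : ∀ {n} → BoolFun n → Set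
NonDecreasing f = ∀ x y → x ≤ᶜ y → f x B.≤ f y

NonIncreasing : ∀ {n} → BoolFun n → Set
NonIncreasing f = ∀ x y → x ≤ᶜ y → f y B.≤ f x

Monotone : ∀ {n} → BoolFun n → Set
Monotone f = NonDecreasing f ⊎ NonIncreasing f

flipAt : ∀ {n} → (Fin n → Bool) → Fin n → (Fin n → Bool)
flipAt x i j with i F.≟ j
... | yes _ = not (x j)
... | no _  = x j

differs : Bool → Bool → ℕ
differs a b = if (a B.xor b) then 1 else 0

sensAt : ∀ {n} → BoolFun n → (Fin n → Bool) → ℕ
sensAt {n} f x = foldr ℕ._+_ 0 (map (λ i → differs (f (flipAt x i)) (f x)) (allFin n))

cube : (n : ℕ) → List (Fin n → Bool)
cube zero = (λ ()) ∷ []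
cube (suc n) = map (λ x → cons false x) (cube n) ++ map (λ x → cons true x) (cube n)
  where
  cons : Bool → (Fin n → Bool) → Fin (suc n) → Bool
  cons b x zero = b
  cons b x (suc i) = x i

sensitivity : ∀ {n} → BoolFun n → ℕ
sensitivity {n} f = foldr _⊔_ 0 (map (sensAt f) (cube n))

-- Polynomials in n variables with rational coefficients:
-- a list of monomials c · x_{i1} ⋯ x_{ik} (variables may repeat).
Monomial : ℕ → Set
Monomial n = ℚ × List (Fin n)

Poly : ℕ → Set
Poly n = List (Monomial n)

degree : ∀ {n} → Poly n → ℕ
degree [] = 0
degree ((c , vs) ∷ p) = length vs ⊔ degree p

boolToℚ : Bool → ℚ
boolToℚ true = 1ℚ
boolToℚ false = 0ℚ

evalMono : ∀ {n} → Monomial n → (Fin n → Bool) → ℚ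
evalMono (c , vs) x = foldr (λ i r → boolToℚ (x i) * r) c vs

eval : ∀ {n} → Poly n → (Fin n → Bool) → ℚ
eval p x = foldr (λ m r → evalMono m x + r) 0ℚ p

-- p one-sidedly approximates f in the sense of N(f):
-- |p(x)| ≤ 1/3 when f(x)=0, |p(x)| ≥ 1 when f(x)=1.
Approximates : ∀ {n} → Poly n → BoolFun n → Set
Approximates p f = ∀ x → (f x ≡ᵇ false → ∣ eval p x ∣ ≤ (+ 1 / 3))
                         × (f x ≡ᵇ true → 1ℚ ≤ ∣ eval p x ∣)
  where
  open import Relation.Binary.PropositionalEquality renaming (_≡_ to _≡ᵇ_)

NDegLe : ∀ {n} → BoolFun n → ℕ → Set
NDegLe f d = Σ (Poly _) λ p → (degree p ℕ.≤ d) × Approximates p f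

{-# OPTIONS --safe #-}
-- Fix x and let S be its set of sensitive coordinates. For monotone f, flipping any nonempty subset of S
-- changes f(x); passing to the complement if necessary, f(x) = 1 and f = 0 at all these flips, so an
-- approximating polynomial p of degree d has |p(x)| ≥ 1 and |p| ≤ 1/3 there. Averaging p over the flips that
-- hit each coordinate of S independently with probability r gives a polynomial E of degree ≤ d in r with
-- E(0) = p(x) and |E(r)| ≤ (1 - r)^|S| |p(x)| + 1/3. If |S| > 64 d², then z ↦ E(z/|S|) is at most
-- |p(x)|/9 + 1/3 at z = 8 and at the nodes z = 64u², 1 ≤ |u| ≤ d, and a Markov-type inequality for these
-- nodes, proved through a vanishing 2d-th finite difference, bounds |E(0) - E(8/|S|)| by the same quantity.
-- This forces |p(x)| ≤ 6/7, a contradiction; hence s(f) ≤ 64 max(d₁², d₂²).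
module Submission where

open import Defs

module RationalArithmetic where

  open import Data.Nat as ℕ using (ℕ; zero; suc)
  open import Data.Rational
  open import Data.Rational.Properties
  open import Data.Rational.Solver
  open import Data.Integer using (+≤+; +<+)
  open import Data.Empty using (⊥-elim)
  open import Relation.Nullary using (yes; no)
  open import Relation.Binary.PropositionalEquality
  open +-*-Solver

  *-monoˡ-≤-0≤ : ∀ {r p q} → 0ℚ ≤ r → p ≤ q → r * p ≤ r * q
  *-monoˡ-≤-0≤ {r} 0≤r = *-monoˡ-≤-nonNeg r {{nonNegative 0≤r}}

  *-monoʳ-≤-0≤ : ∀ {r p q} → 0ℚ ≤ r → p ≤ q → p * r ≤ q * r
  *-monoʳ-≤-0≤ {r} 0≤r = *-monoʳ-≤-nonNeg r {{nonNegative 0≤r}}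

  *-cancelˡ-≤-0< : ∀ {r p q} → 0ℚ < r → r * p ≤ r * q → p ≤ q
  *-cancelˡ-≤-0< {r} 0<r = *-cancelˡ-≤-pos r {{positive 0<r}}

  *-nonNeg : ∀ {p q} → 0ℚ ≤ p → 0ℚ ≤ q → 0ℚ ≤ p * q
  *-nonNeg {p} {q} 0≤p 0≤q = subst (_≤ p * q) (*-zeroˡ q) (*-monoʳ-≤-0≤ 0≤q 0≤p)

  0≤1 : 0ℚ ≤ 1ℚ
  0≤1 = *≤* (+≤+ ℕ.z≤n)

  0<1 : 0ℚ < 1ℚ
  0<1 = *<* (+<+ (ℕ.s≤s ℕ.z≤n))

  p≤q⇒0≤q-p : ∀ {p q} → p ≤ q → 0ℚ ≤ q - p
  p≤q⇒0≤q-p {p} {q} p≤q = subst (_≤ q - p) (+-inverseʳ p) (+-monoˡ-≤ (- p) p≤q)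

  -- Inequalities between polynomial expressions are proved by exhibiting the gap c and leaving b ≡ a + c to the ring solver.
  ≤-byGap : ∀ a b c → 0ℚ ≤ c → b ≡ a + c → a ≤ b
  ≤-byGap a b c 0≤c b≡a+c = subst (_≤ b) (+-identityʳ a) (subst (a + 0ℚ ≤_) (sym b≡a+c) (+-monoʳ-≤ a 0≤c))

  -- A total reciprocal with junk value 0 ⁻¹ = 0, so that no NonZero instance has to be threaded through definitions.
  _⁻¹ : ℚ → ℚ
  p ⁻¹ with p ≟ 0ℚ
  ... | yes _ = 0ℚ
  ... | no p≢0 = (1/ p) {{≢-nonZero p≢0}}

  ⁻¹-inverseʳ : ∀ {p} → p ≢ 0ℚ → p * p ⁻¹ ≡ 1ℚ
  ⁻¹-inverseʳ {p} p≢0 with p ≟ 0ℚ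
  ... | yes p≡0 = ⊥-elim (p≢0 p≡0)
  ... | no p≢0′ = *-inverseʳ p {{≢-nonZero p≢0′}}

  pos⇒⁻¹-nonNeg : ∀ {p} → 0ℚ < p → 0ℚ ≤ p ⁻¹
  pos⇒⁻¹-nonNeg {p} 0<p with p ≟ 0ℚ
  ... | yes _ = ≤-refl
  ... | no p≢0 = <⇒≤ (positive⁻¹ _ {{1/pos⇒pos p {{positive 0<p}}}})

  neg⇒⁻¹-nonPos : ∀ {p} → p < 0ℚ → p ⁻¹ ≤ 0ℚ
  neg⇒⁻¹-nonPos {p} p<0 with p ≟ 0ℚ
  ... | yes _ = ≤-refl
  ... | no p≢0 = <⇒≤ (negative⁻¹ _ {{1/neg⇒neg p {{negative p<0}}}})

  ⁻¹-unique : ∀ {a b} → a * b ≡ 1ℚ → a ⁻¹ ≡ b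
  ⁻¹-unique {a} {b} ab≡1 = begin
      a ⁻¹              ≡⟨ solve 2 (λ x y → x := x :* con 1ℚ) refl (a ⁻¹) b ⟩
      a ⁻¹ * 1ℚ         ≡⟨ cong (a ⁻¹ *_) (sym ab≡1) ⟩
      a ⁻¹ * (a * b)    ≡⟨ solve 3 (λ x y z → x :* (y :* z) := (y :* x) :* z) refl (a ⁻¹) a b ⟩
      (a * a ⁻¹) * b    ≡⟨ cong (_* b) (⁻¹-inverseʳ a≢0) ⟩
      1ℚ * b            ≡⟨ *-identityˡ b ⟩
      b                 ∎
    where
    open ≡-Reasoning
    a≢0 : a ≢ 0ℚ
    a≢0 a≡0 = 1≢0 (trans (sym ab≡1) (trans (cong (_* b) a≡0) (*-zeroˡ b)))

  ⁻¹-distrib-* : ∀ {a b} → a ≢ 0ℚ → b ≢ 0ℚ → (a * b) ⁻¹ ≡ a ⁻¹ * b ⁻¹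
  ⁻¹-distrib-* {a} {b} a≢0 b≢0 = ⁻¹-unique {a * b} (begin
      (a * b) * (a ⁻¹ * b ⁻¹)  ≡⟨ solve 4 (λ a b a′ b′ → (a :* b) :* (a′ :* b′) := (a :* a′) :* (b :* b′)) refl a b (a ⁻¹) (b ⁻¹) ⟩
      (a * a ⁻¹) * (b * b ⁻¹)  ≡⟨ cong₂ _*_ (⁻¹-inverseʳ a≢0) (⁻¹-inverseʳ b≢0) ⟩
      1ℚ                       ∎)
    where open ≡-Reasoning

  ⁻¹-difference : ∀ {a b} → a ≢ 0ℚ → b ≢ 0ℚ → a ⁻¹ - b ⁻¹ ≡ (b - a) * (a ⁻¹ * b ⁻¹)
  ⁻¹-difference {a} {b} a≢0 b≢0 = begin
      a ⁻¹ - b ⁻¹                        ≡⟨ solve 2 (λ x y → x :- y := x :* con 1ℚ :- y :* con 1ℚ) refl (a ⁻¹) (b ⁻¹) ⟩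
      a ⁻¹ * 1ℚ - b ⁻¹ * 1ℚ              ≡⟨ cong₂ (λ u v → a ⁻¹ * u - b ⁻¹ * v) (sym (⁻¹-inverseʳ b≢0)) (sym (⁻¹-inverseʳ a≢0)) ⟩
      a ⁻¹ * (b * b ⁻¹) - b ⁻¹ * (a * a ⁻¹) ≡⟨ solve 4 (λ a′ a b b′ → a′ :* (b :* b′) :- b′ :* (a :* a′) := (b :- a) :* (a′ :* b′)) refl (a ⁻¹) a b (b ⁻¹) ⟩
      (b - a) * (a ⁻¹ * b ⁻¹)            ∎
    where open ≡-Reasoning

  fromℕ : ℕ → ℚ
  fromℕ zero = 0ℚ
  fromℕ (suc n) = fromℕ n + 1ℚ

  fromℕ-nonNeg : ∀ n → 0ℚ ≤ fromℕ n
  fromℕ-nonNeg zero = ≤-refl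
  fromℕ-nonNeg (suc n) = +-mono-≤ (fromℕ-nonNeg n) 0≤1

  fromℕ-mono-≤ : ∀ {m n} → m ℕ.≤ n → fromℕ m ≤ fromℕ n
  fromℕ-mono-≤ {zero} {n} _ = fromℕ-nonNeg n
  fromℕ-mono-≤ {suc m} {suc n} (ℕ.s≤s m≤n) = +-monoˡ-≤ 1ℚ (fromℕ-mono-≤ m≤n)

  fromℕ-<⇒+1≤ : ∀ {m n} → m ℕ.< n → fromℕ m + 1ℚ ≤ fromℕ n
  fromℕ-<⇒+1≤ {m} {suc n} (ℕ.s≤s m≤n) = +-monoˡ-≤ 1ℚ (fromℕ-mono-≤ m≤n)

  fromℕ-pos : ∀ {n} → 0 ℕ.< n → 0ℚ < fromℕ n
  fromℕ-pos 0<n = <-≤-trans 0<1 (fromℕ-<⇒+1≤ 0<n)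

  fromℕ-+ : ∀ m n → fromℕ (m ℕ.+ n) ≡ fromℕ m + fromℕ n
  fromℕ-+ zero n = sym (+-identityˡ (fromℕ n))
  fromℕ-+ (suc m) n = trans (cong (_+ 1ℚ) (fromℕ-+ m n))
    (solve 3 (λ x y z → (x :+ y) :+ z := (x :+ z) :+ y) refl (fromℕ m) (fromℕ n) 1ℚ)

  fromℕ-* : ∀ m n → fromℕ (m ℕ.* n) ≡ fromℕ m * fromℕ n
  fromℕ-* zero n = sym (*-zeroˡ (fromℕ n))
  fromℕ-* (suc m) n = trans (fromℕ-+ n (m ℕ.* n)) (trans (cong (fromℕ n +_) (fromℕ-* m n))
    (solve 2 (λ x y → y :+ x :* y := (x :+ con 1ℚ) :* y) refl (fromℕ m) (fromℕ n)))

module PolynomialFunctions where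

  open import Data.Nat as ℕ using (ℕ; zero; suc; _∸_)
  import Data.Nat.Properties as ℕ
  open import Data.Rational
  open import Data.Rational.Properties
  open import Data.Rational.Solver
  open import Data.Product using (Σ; _,_; _×_)
  open import Relation.Binary.PropositionalEquality
  open +-*-Solver

  data HasDegree≤ : ℕ → (ℚ → ℚ) → Set where
    const  : ∀ {k} c → HasDegree≤ k (λ _ → c)
    add    : ∀ {k F G} → HasDegree≤ k F → HasDegree≤ k G → HasDegree≤ k (λ x → F x + G x)
    scale  : ∀ {k F} c → HasDegree≤ k F → HasDegree≤ k (λ x → c * F x)
    mulX   : ∀ {k F} → HasDegree≤ k F → HasDegree≤ (suc k) (λ x → x * F x)
    ext    : ∀ {k F G} → (∀ x → F x ≡ G x) → HasDegree≤ k F → HasDegree≤ k G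
    weaken : ∀ {j k F} → j ℕ.≤ k → HasDegree≤ j F → HasDegree≤ k F

  deg0⇒const : ∀ {F} → HasDegree≤ 0 F → ∀ x y → F x ≡ F y
  deg0⇒const (const c) x y = refl
  deg0⇒const (add dF dG) x y = cong₂ _+_ (deg0⇒const dF x y) (deg0⇒const dG x y)
  deg0⇒const (scale c dF) x y = cong (c *_) (deg0⇒const dF x y)
  deg0⇒const (ext F≗G dF) x y = trans (sym (F≗G x)) (trans (deg0⇒const dF x y) (F≗G y))
  deg0⇒const (weaken ℕ.z≤n dF) x y = deg0⇒const dF x y

  deg-sub : ∀ {k F G} → HasDegree≤ k F → HasDegree≤ k G → HasDegree≤ k (λ x → F x - G x)
  deg-sub {F = F} {G} dF dG = ext (λ x → solve 2 (λ a b → a :+ con (- 1ℚ) :* b := a :- b) refl (F x) (G x))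
    (add dF (scale (- 1ℚ) dG))

  deg-* : ∀ {j k F G} → HasDegree≤ j F → HasDegree≤ k G → HasDegree≤ (j ℕ.+ k) (λ x → F x * G x)
  deg-* {j} {k} (const c) dG = weaken (ℕ.m≤n+m k j) (scale c dG)
  deg-* {G = G} (add {F = F₁} {F₂} dF₁ dF₂) dG =
    ext (λ x → sym (*-distribʳ-+ (G x) (F₁ x) (F₂ x))) (add (deg-* dF₁ dG) (deg-* dF₂ dG))
  deg-* {G = G} (scale {F = F} c dF) dG = ext (λ x → sym (*-assoc c (F x) (G x))) (scale c (deg-* dF dG))
  deg-* {G = G} (mulX {F = F} dF) dG = ext (λ x → sym (*-assoc x (F x) (G x))) (mulX (deg-* dF dG))
  deg-* {G = G} (ext F≗F′ dF) dG = ext (λ x → cong (_* G x) (F≗F′ x)) (deg-* dF dG)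
  deg-* {k = k} (weaken i≤j dF) dG = weaken (ℕ.+-monoˡ-≤ k i≤j) (deg-* dF dG)

  deg-∘ : ∀ {j k φ G} → HasDegree≤ j φ → HasDegree≤ k G → HasDegree≤ (k ℕ.* j) (λ x → G (φ x))
  deg-∘ dφ (const c) = const c
  deg-∘ dφ (add dF dG) = add (deg-∘ dφ dF) (deg-∘ dφ dG)
  deg-∘ dφ (scale c dF) = scale c (deg-∘ dφ dF)
  deg-∘ dφ (mulX dF) = deg-* dφ (deg-∘ dφ dF)
  deg-∘ dφ (ext F≗G dF) = ext (λ x → F≗G _) (deg-∘ dφ dF)
  deg-∘ {j} dφ (weaken i≤k dF) = weaken (ℕ.*-monoˡ-≤ j i≤k) (deg-∘ dφ dF)

  deg-id : HasDegree≤ 1 (λ x → x)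
  deg-id = ext *-identityʳ (mulX (const 1ℚ))

  deg-affine : ∀ a b → HasDegree≤ 1 (λ x → a * x + b)
  deg-affine a b = add (scale a deg-id) (const b)

  deg-∘-affine : ∀ {k G} a b → HasDegree≤ k G → HasDegree≤ k (λ x → G (a * x + b))
  deg-∘-affine {k} a b dG = subst (λ m → HasDegree≤ m _) (ℕ.*-identityʳ k) (deg-∘ (deg-affine a b) dG)

  deg-shift : ∀ {k G} c → HasDegree≤ k G → HasDegree≤ k (λ x → G (x + c))
  deg-shift {G = G} c dG = ext (λ x → cong G (cong (_+ c) (*-identityˡ x))) (deg-∘-affine 1ℚ c dG)

  deg-rescale : ∀ {k G} c → HasDegree≤ k G → HasDegree≤ k (λ x → G (x * c))
  deg-rescale {G = G} c dG = ext (λ x → cong G (trans (+-identityʳ (c * x)) (*-comm c x))) (deg-∘-affine c 0ℚ dG)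

  deg-Δ : ∀ {k H} → HasDegree≤ k H → HasDegree≤ (k ∸ 1) (λ x → H (x + 1ℚ) - H x)
  deg-Δ (const c) = ext (λ x → sym (+-inverseʳ c)) (const 0ℚ)
  deg-Δ (add {F = F} {G} dF dG) = ext (λ x → solve 4 (λ a b c e → (a :- c) :+ (b :- e) := (a :+ b) :- (c :+ e)) refl (F (x + 1ℚ)) (G (x + 1ℚ)) (F x) (G x))
    (add (deg-Δ dF) (deg-Δ dG))
  deg-Δ (scale {F = F} c dF) = ext (λ x → solve 3 (λ c a b → c :* (a :- b) := c :* a :- c :* b) refl c (F (x + 1ℚ)) (F x))
    (scale c (deg-Δ dF))
  deg-Δ (mulX {k = zero} {F} dF) = ext Δ[xF] (deg-shift 1ℚ dF)
    where
    Δ[xF] : ∀ x → F (x + 1ℚ) ≡ (x + 1ℚ) * F (x + 1ℚ) - x * F x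
    Δ[xF] x = begin
        F (x + 1ℚ)
          ≡⟨ solve 3 (λ x a b → a := (x :+ con 1ℚ) :* a :- x :* b :+ x :* (b :- a)) refl x (F (x + 1ℚ)) (F x) ⟩
        (x + 1ℚ) * F (x + 1ℚ) - x * F x + x * (F x - F (x + 1ℚ))
          ≡⟨ cong (λ t → (x + 1ℚ) * F (x + 1ℚ) - x * F x + x * (F x - t)) (deg0⇒const dF (x + 1ℚ) x) ⟩
        (x + 1ℚ) * F (x + 1ℚ) - x * F x + x * (F x - F x)
          ≡⟨ solve 3 (λ x a b → a :+ x :* (b :- b) := a) refl x ((x + 1ℚ) * F (x + 1ℚ) - x * F x) (F x) ⟩
        (x + 1ℚ) * F (x + 1ℚ) - x * F x ∎
      where open ≡-Reasoning
  deg-Δ (mulX {k = suc k} {F} dF) = ext Δ[xF] (add (mulX (deg-Δ dF)) (deg-shift 1ℚ dF))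
    where
    Δ[xF] : ∀ x → x * (F (x + 1ℚ) - F x) + F (x + 1ℚ) ≡ (x + 1ℚ) * F (x + 1ℚ) - x * F x
    Δ[xF] x = solve 3 (λ x a b → x :* (a :- b) :+ a := (x :+ con 1ℚ) :* a :- x :* b) refl x (F (x + 1ℚ)) (F x)
  deg-Δ (ext F≗G dF) = ext (λ x → cong₂ _-_ (F≗G _) (F≗G x)) (deg-Δ dF)
  deg-Δ (weaken j≤k dF) = weaken (ℕ.∸-monoˡ-≤ 1 j≤k) (deg-Δ dF)

  factorTheorem : ∀ {k F} a → HasDegree≤ k F →
                  Σ (ℚ → ℚ) λ G → HasDegree≤ (k ∸ 1) G × (∀ z → F z ≡ F a + (z - a) * G z)
  factorTheorem a (const c) = (λ _ → 0ℚ) , const 0ℚ , λ z → solve 2 (λ c z → c := c :+ z :* con 0ℚ) refl c (z - a)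
  factorTheorem a (add {F = F₁} {F₂} dF₁ dF₂) with factorTheorem a dF₁ | factorTheorem a dF₂
  ... | G₁ , dG₁ , F₁≡ | G₂ , dG₂ , F₂≡ = (λ z → G₁ z + G₂ z) , add dG₁ dG₂ , λ z →
    trans (cong₂ _+_ (F₁≡ z) (F₂≡ z))
      (solve 5 (λ p q w u v → (p :+ w :* u) :+ (q :+ w :* v) := (p :+ q) :+ w :* (u :+ v)) refl (F₁ a) (F₂ a) (z - a) (G₁ z) (G₂ z))
  factorTheorem a (scale {F = F} c dF) with factorTheorem a dF
  ... | G , dG , F≡ = (λ z → c * G z) , scale c dG , λ z →
    trans (cong (c *_) (F≡ z)) (solve 4 (λ c p w u → c :* (p :+ w :* u) := c :* p :+ w :* (c :* u)) refl c (F a) (z - a) (G z))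
  factorTheorem a (mulX {k} {F} dF) with factorTheorem a dF
  ... | G , dG , F≡ = (λ z → F z + a * G z) , add dF (weaken (ℕ.m∸n≤m k 1) (scale a dG)) , xF≡
    where
    xF≡ : ∀ z → z * F z ≡ a * F a + (z - a) * (F z + a * G z)
    xF≡ z = begin
        z * F z
          ≡⟨ cong (z *_) (F≡ z) ⟩
        z * (F a + (z - a) * G z)
          ≡⟨ solve 4 (λ z a p u → z :* (p :+ (z :- a) :* u) := a :* p :+ (z :- a) :* ((p :+ (z :- a) :* u) :+ a :* u)) refl z a (F a) (G z) ⟩
        a * F a + (z - a) * ((F a + (z - a) * G z) + a * G z)
          ≡⟨ cong (λ t → a * F a + (z - a) * (t + a * G z)) (sym (F≡ z)) ⟩
        a * F a + (z - a) * (F z + a * G z) ∎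
      where open ≡-Reasoning
  factorTheorem a (ext F≗H dF) with factorTheorem a dF
  ... | G , dG , F≡ = G , dG , λ z → trans (sym (F≗H z)) (trans (F≡ z) (cong (λ t → t + (z - a) * G z) (F≗H a)))
  factorTheorem a (weaken j≤k dF) with factorTheorem a dF
  ... | G , dG , F≡ = G , weaken (ℕ.∸-monoˡ-≤ 1 j≤k) dG , F≡

module BinomialCoefficients where

  open import Data.Nat
  open import Data.Nat.Properties
  open import Data.Nat.Combinatorics using (_C_; k>n⇒nCk≡0; nCk≡nC[n∸k]; nCn≡1; nC1≡n; nCk+nC[k+1]≡[n+1]C[k+1])
  open import Data.Nat.Solver using (module +-*-Solver)
  open import Data.Sum using (inj₁; inj₂)
  open import Relation.Nullary using (yes; no)
  open import Relation.Binary.PropositionalEquality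
  open +-*-Solver

  nC0≡1 : ∀ n → n C 0 ≡ 1
  nC0≡1 n = trans (nCk≡nC[n∸k] {0} {n} z≤n) (nCn≡1 n)

  C-pos : ∀ {n k} → k ≤ n → 0 < n C k
  C-pos {n} {zero} _ = subst (0 <_) (sym (nC0≡1 n)) (s≤s z≤n)
  C-pos {suc n} {suc k} (s≤s k≤n) =
    subst (0 <_) (nCk+nC[k+1]≡[n+1]C[k+1] n k) (<-≤-trans (C-pos k≤n) (m≤m+n (n C k) _))

  C-ratio : ∀ n k → (n C suc k) * suc k ≡ (n C k) * (n ∸ k)
  C-ratio zero zero = refl
  C-ratio zero (suc k) = refl
  C-ratio (suc n) zero = begin
      (suc n C 1) * 1  ≡⟨ cong (_* 1) (nC1≡n (suc n)) ⟩
      suc n * 1      ≡⟨ solve 1 (λ n → n :* con 1 := con 1 :* n) refl (suc n) ⟩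
      1 * suc n      ≡⟨ cong (_* suc n) (sym (nC0≡1 (suc n))) ⟩
      (suc n C 0) * suc n ∎
    where open ≡-Reasoning
  C-ratio (suc n) (suc k) with k <? n
  ... | yes k<n = begin
      (suc n C suc (suc k)) * suc (suc k)
        ≡⟨ cong (_* suc (suc k)) (sym (nCk+nC[k+1]≡[n+1]C[k+1] n (suc k))) ⟩
      (n C suc k + n C suc (suc k)) * suc (suc k)
        ≡⟨ solve 3 (λ a b k → (a :+ b) :* (con 2 :+ k) := a :* (con 1 :+ k) :+ a :+ b :* (con 2 :+ k)) refl (n C suc k) (n C suc (suc k)) k ⟩
      (n C suc k) * suc k + n C suc k + (n C suc (suc k)) * suc (suc k)
        ≡⟨ cong₂ (λ a b → a + n C suc k + b) (C-ratio n k) (C-ratio n (suc k)) ⟩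
      (n C k) * (n ∸ k) + n C suc k + (n C suc k) * (n ∸ suc k)
        ≡⟨ solve 3 (λ a b c → a :+ b :+ b :* c := a :+ b :* (con 1 :+ c)) refl ((n C k) * (n ∸ k)) (n C suc k) (n ∸ suc k) ⟩
      (n C k) * (n ∸ k) + (n C suc k) * suc (n ∸ suc k)
        ≡⟨ cong (λ t → (n C k) * (n ∸ k) + (n C suc k) * t) (sym (+-∸-assoc 1 k<n)) ⟩
      (n C k) * (n ∸ k) + (n C suc k) * (n ∸ k)
        ≡⟨ sym (*-distribʳ-+ (n ∸ k) (n C k) (n C suc k)) ⟩
      (n C k + n C suc k) * (n ∸ k)
        ≡⟨ cong (_* (n ∸ k)) (nCk+nC[k+1]≡[n+1]C[k+1] n k) ⟩
      (suc n C suc k) * (suc n ∸ suc k) ∎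
    where open ≡-Reasoning
  ... | no k≮n = begin
      (suc n C suc (suc k)) * suc (suc k)  ≡⟨ cong (_* suc (suc k)) (k>n⇒nCk≡0 (s≤s (s≤s n≤k))) ⟩
      0                                  ≡⟨ sym (*-zeroʳ (suc n C suc k)) ⟩
      (suc n C suc k) * 0                  ≡⟨ cong ((suc n C suc k) *_) (sym (m≤n⇒m∸n≡0 n≤k)) ⟩
      (suc n C suc k) * (n ∸ k)            ∎
    where
    open ≡-Reasoning
    n≤k : n ≤ k
    n≤k = ≮⇒≥ k≮n

  C-increasing : ∀ m t → t < m → (m + m) C t ≤ (m + m) C suc t
  C-increasing m t t<m = *-cancelʳ-≤ ((m + m) C t) ((m + m) C suc t) (suc t) (begin
      ((m + m) C t) * suc t        ≤⟨ *-monoʳ-≤ ((m + m) C t) t<2m-t ⟩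
      ((m + m) C t) * (m + m ∸ t)  ≡⟨ sym (C-ratio (m + m) t) ⟩
      ((m + m) C suc t) * suc t    ∎)
    where
    open ≤-Reasoning
    t<2m-t : suc t ≤ m + m ∸ t
    t<2m-t = subst (suc t ≤_) (sym (+-∸-assoc m (<⇒≤ t<m))) (≤-trans t<m (m≤m+n m (m ∸ t)))

  C-decreasing : ∀ m t → m ≤ t → (m + m) C suc t ≤ (m + m) C t
  C-decreasing m t m≤t = *-cancelʳ-≤ ((m + m) C suc t) ((m + m) C t) (suc t) (begin
      ((m + m) C suc t) * suc t    ≡⟨ C-ratio (m + m) t ⟩
      ((m + m) C t) * (m + m ∸ t)  ≤⟨ *-monoʳ-≤ ((m + m) C t) 2m-t≤t+1 ⟩
      ((m + m) C t) * suc t        ∎)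
    where
    open ≤-Reasoning
    2m-t≤t+1 : m + m ∸ t ≤ suc t
    2m-t≤t+1 = ≤-trans (∸-monoʳ-≤ (m + m) m≤t) (subst (_≤ suc t) (sym (m+n∸n≡m m m)) (≤-trans m≤t (n≤1+n t)))

  C-central-max : ∀ m t → (m + m) C t ≤ (m + m) C m
  C-central-max m t with t ≤? m
  ... | yes t≤m = below (m ∸ t) t (m+[n∸m]≡n t≤m)
    where
    below : ∀ d t → t + d ≡ m → (m + m) C t ≤ (m + m) C m
    below zero t t+0≡m = ≤-reflexive (cong ((m + m) C_) (trans (sym (+-identityʳ t)) t+0≡m))
    below (suc d) t t+d+1≡m = ≤-trans (C-increasing m t t<m) (below d (suc t) (trans (sym (+-suc t d)) t+d+1≡m))
      where
      t<m : t < m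
      t<m = subst (t <_) t+d+1≡m (subst (_≤ t + suc d) (+-comm t 1) (+-monoʳ-≤ t (s≤s z≤n)))
  ... | no t≰m = above t (<⇒≤ (≰⇒> t≰m))
    where
    above : ∀ t → m ≤ t → (m + m) C t ≤ (m + m) C m
    above t m≤t with m≤n⇒m<n∨m≡n m≤t
    ... | inj₂ refl = ≤-refl
    above (suc t) _ | inj₁ (s≤s m≤t) = ≤-trans (C-decreasing m t m≤t) (above t m≤t)

module FiniteSums where

  open import Data.Nat as ℕ using (ℕ; zero; suc)
  import Data.Nat.Properties as ℕ
  open import Data.Rational
  open import Data.Rational.Properties
  open import Data.Rational.Solver
  open import Data.Empty using (⊥-elim)
  open import Data.Sum using (inj₁; inj₂)
  open import Relation.Nullary using (yes; no)
  open import Relation.Binary.PropositionalEquality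
  open +-*-Solver

  ∑ : ℕ → (ℕ → ℚ) → ℚ
  ∑ zero f = 0ℚ
  ∑ (suc n) f = ∑ n f + f n

  syntax ∑ n (λ t → e) = ∑[ t < n ] e

  ∑-cong : ∀ n {f g} → (∀ t → t ℕ.< n → f t ≡ g t) → ∑ n f ≡ ∑ n g
  ∑-cong zero f≗g = refl
  ∑-cong (suc n) f≗g = cong₂ _+_ (∑-cong n (λ t t<n → f≗g t (ℕ.m<n⇒m<1+n t<n))) (f≗g n ℕ.≤-refl)

  ∑-first : ∀ n f → ∑ (suc n) f ≡ f 0 + ∑[ t < n ] f (suc t)
  ∑-first zero f = +-comm 0ℚ (f 0)
  ∑-first (suc n) f = trans (cong (_+ f (suc n)) (∑-first n f)) (+-assoc (f 0) _ _)

  ∑-*ˡ : ∀ n c f → ∑[ t < n ] (c * f t) ≡ c * ∑ n f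
  ∑-*ˡ zero c f = sym (*-zeroʳ c)
  ∑-*ˡ (suc n) c f = trans (cong (_+ c * f n) (∑-*ˡ n c f)) (sym (*-distribˡ-+ c (∑ n f) (f n)))

  ∑-distrib-sub : ∀ n f g → ∑[ t < n ] (f t - g t) ≡ ∑ n f - ∑ n g
  ∑-distrib-sub zero f g = sym (+-inverseʳ 0ℚ)
  ∑-distrib-sub (suc n) f g = trans (cong (_+ (f n - g n)) (∑-distrib-sub n f g))
    (solve 4 (λ a b c d → (a :- b) :+ (c :- d) := (a :+ c) :- (b :+ d)) refl (∑ n f) (∑ n g) (f n) (g n))

  ∑-triangle : ∀ n f → ∣ ∑ n f ∣ ≤ ∑[ t < n ] ∣ f t ∣
  ∑-triangle zero f = ≤-refl
  ∑-triangle (suc n) f = ≤-trans (∣p+q∣≤∣p∣+∣q∣ (∑ n f) (f n)) (+-monoˡ-≤ ∣ f n ∣ (∑-triangle n f))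

  ∑-mono-≤ : ∀ n {f g} → (∀ t → t ℕ.< n → f t ≤ g t) → ∑ n f ≤ ∑ n g
  ∑-mono-≤ zero f≤g = ≤-refl
  ∑-mono-≤ (suc n) f≤g = +-mono-≤ (∑-mono-≤ n (λ t t<n → f≤g t (ℕ.m<n⇒m<1+n t<n))) (f≤g n ℕ.≤-refl)

  ∑-telescope : ∀ n (φ : ℕ → ℚ) → ∑[ t < n ] (φ t - φ (suc t)) ≡ φ 0 - φ n
  ∑-telescope zero φ = sym (+-inverseʳ (φ 0))
  ∑-telescope (suc n) φ = trans (cong (_+ (φ n - φ (suc n))) (∑-telescope n φ))
    (solve 3 (λ a b c → (a :- b) :+ (b :- c) := a :- c) refl (φ 0) (φ n) (φ (suc n)))

  except : ℕ → (ℕ → ℚ) → ℕ → ℚ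
  except m f t with t ℕ.≟ m
  ... | yes _ = 0ℚ
  ... | no _ = f t

  except-≢ : ∀ {m t} f → t ≢ m → except m f t ≡ f t
  except-≢ {m} {t} f t≢m with t ℕ.≟ m
  ... | yes t≡m = ⊥-elim (t≢m t≡m)
  ... | no _ = refl

  except-≡ : ∀ {m t} f → t ≡ m → except m f t ≡ 0ℚ
  except-≡ {m} {t} f t≡m with t ℕ.≟ m
  ... | yes _ = refl
  ... | no t≢m = ⊥-elim (t≢m t≡m)

  ∑-except : ∀ n {m} f → m ℕ.< n → ∑ n f ≡ f m + ∑ n (except m f)
  ∑-except (suc n) {m} f m<1+n with ℕ.m≤n⇒m<n∨m≡n (ℕ.≤-pred m<1+n)
  ... | inj₁ m<n = begin
      ∑ n f + f n                            ≡⟨ cong (_+ f n) (∑-except n f m<n) ⟩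
      f m + ∑ n (except m f) + f n           ≡⟨ +-assoc (f m) _ _ ⟩
      f m + (∑ n (except m f) + f n)         ≡⟨ cong (λ v → f m + (∑ n (except m f) + v)) (sym (except-≢ f (ℕ.>⇒≢ m<n))) ⟩
      f m + ∑ (suc n) (except m f)           ∎
    where open ≡-Reasoning
  ... | inj₂ refl = begin
      ∑ m f + f m                            ≡⟨ cong (_+ f m) (∑-cong m (λ t t<m → sym (except-≢ f (ℕ.<⇒≢ t<m)))) ⟩
      ∑ m (except m f) + f m                 ≡⟨ +-comm _ (f m) ⟩
      f m + ∑ m (except m f)                 ≡⟨ cong (f m +_) (sym (+-identityʳ _)) ⟩
      f m + (∑ m (except m f) + 0ℚ)          ≡⟨ cong (λ v → f m + (∑ m (except m f) + v)) (sym (except-≡ {m} f refl)) ⟩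
      f m + ∑ (suc m) (except m f)           ∎
    where open ≡-Reasoning

module AlternatingSums where

  open import Data.Nat as ℕ using (ℕ; zero; suc)
  import Data.Nat.Properties as ℕ
  open import Data.Nat.Combinatorics using (_C_; k>n⇒nCk≡0; nCk+nC[k+1]≡[n+1]C[k+1])
  open import Data.Rational
  open import Data.Rational.Properties
  open import Data.Rational.Solver
  open import Relation.Binary.PropositionalEquality
  open +-*-Solver
  open RationalArithmetic
  open PolynomialFunctions
  open BinomialCoefficients using (nC0≡1)
  open FiniteSums

  sign : ℕ → ℚ
  sign zero = 1ℚ
  sign (suc t) = - sign t

  binomialWeight : ℕ → ℕ → ℚ
  binomialWeight n t = sign t * fromℕ (n C t)

  ∣binomialWeight∣ : ∀ n t → ∣ binomialWeight n t ∣ ≡ fromℕ (n C t)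
  ∣binomialWeight∣ n t = begin
      ∣ sign t * fromℕ (n C t) ∣        ≡⟨ ∣p*q∣≡∣p∣*∣q∣ (sign t) (fromℕ (n C t)) ⟩
      ∣ sign t ∣ * ∣ fromℕ (n C t) ∣    ≡⟨ cong₂ _*_ (∣sign∣ t) (0≤p⇒∣p∣≡p (fromℕ-nonNeg (n C t))) ⟩
      1ℚ * fromℕ (n C t)                ≡⟨ *-identityˡ _ ⟩
      fromℕ (n C t)                     ∎
    where
    open ≡-Reasoning
    ∣sign∣ : ∀ t → ∣ sign t ∣ ≡ 1ℚ
    ∣sign∣ zero = refl
    ∣sign∣ (suc t) = trans (∣-p∣≡∣p∣ (sign t)) (∣sign∣ t)

  binomialWeight-0 : ∀ n → binomialWeight n 0 ≡ 1ℚ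
  binomialWeight-0 n = cong (λ c → 1ℚ * fromℕ c) (nC0≡1 n)

  binomialWeight-beyond : ∀ n → binomialWeight n (suc n) ≡ 0ℚ
  binomialWeight-beyond n = trans (cong (λ c → sign (suc n) * fromℕ c) (k>n⇒nCk≡0 {n} ℕ.≤-refl)) (*-zeroʳ (sign (suc n)))

  binomialWeight-pascal : ∀ n t → binomialWeight (suc n) (suc t) ≡ binomialWeight n (suc t) - binomialWeight n t
  binomialWeight-pascal n t = begin
      - sign t * fromℕ (suc n C suc t)                         ≡⟨ cong (λ c → - sign t * fromℕ c) (sym (nCk+nC[k+1]≡[n+1]C[k+1] n t)) ⟩
      - sign t * fromℕ (n C t ℕ.+ n C suc t)                   ≡⟨ cong (- sign t *_) (fromℕ-+ (n C t) (n C suc t)) ⟩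
      - sign t * (fromℕ (n C t) + fromℕ (n C suc t))           ≡⟨ solve 3 (λ s a b → (:- s) :* (a :+ b) := (:- s) :* b :- s :* a) refl (sign t) (fromℕ (n C t)) (fromℕ (n C suc t)) ⟩
      - sign t * fromℕ (n C suc t) - sign t * fromℕ (n C t)    ∎
    where open ≡-Reasoning

  -- The n-th forward difference of H at 0, up to the sign (-1)ⁿ.
  alternatingSum : ℕ → (ℚ → ℚ) → ℚ
  alternatingSum n H = ∑[ t < suc n ] (binomialWeight n t * H (fromℕ t))

  alternatingSum-cong : ∀ n {F G} → (∀ x → F x ≡ G x) → alternatingSum n F ≡ alternatingSum n G
  alternatingSum-cong n F≗G = ∑-cong (suc n) (λ t _ → cong (binomialWeight n t *_) (F≗G (fromℕ t)))

  alternatingSum-sub : ∀ n F G → alternatingSum n (λ x → F x - G x) ≡ alternatingSum n F - alternatingSum n G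
  alternatingSum-sub n F G = trans
    (∑-cong (suc n) (λ t _ → solve 3 (λ w a b → w :* (a :- b) := w :* a :- w :* b) refl (binomialWeight n t) (F (fromℕ t)) (G (fromℕ t))))
    (∑-distrib-sub (suc n) _ _)

  alternatingSum-suc : ∀ n H → alternatingSum (suc n) H ≡ alternatingSum n H - alternatingSum n (λ x → H (x + 1ℚ))
  alternatingSum-suc n H = sym (begin
      A - B
        ≡⟨ cong (_- B) (∑-first n (λ t → w n t * H (fromℕ t))) ⟩
      (w n 0 * H 0ℚ + A⁺) - B
        ≡⟨ cong (λ u → (u * H 0ℚ + A⁺) - B) (binomialWeight-0 n) ⟩
      (1ℚ * H 0ℚ + A⁺) - B
        ≡⟨ solve 4 (λ h a b z → (con 1ℚ :* h :+ a) :- b := con 1ℚ :* h :+ ((a :+ con 0ℚ :* z) :- b)) refl (H 0ℚ) A⁺ B (H (fromℕ n + 1ℚ)) ⟩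
      1ℚ * H 0ℚ + ((A⁺ + 0ℚ * H (fromℕ n + 1ℚ)) - B)
        ≡⟨ cong (λ u → 1ℚ * H 0ℚ + ((A⁺ + u * H (fromℕ n + 1ℚ)) - B)) (sym (binomialWeight-beyond n)) ⟩
      1ℚ * H 0ℚ + (∑[ t < suc n ] (w n (suc t) * H (fromℕ t + 1ℚ)) - B)
        ≡⟨ cong (1ℚ * H 0ℚ +_) (sym (∑-distrib-sub (suc n) _ _)) ⟩
      1ℚ * H 0ℚ + ∑[ t < suc n ] (w n (suc t) * H (fromℕ t + 1ℚ) - w n t * H (fromℕ t + 1ℚ))
        ≡⟨ cong₂ (λ u v → u * H 0ℚ + v) (sym (binomialWeight-0 (suc n))) (∑-cong (suc n) (λ t _ → pascal t)) ⟩
      w (suc n) 0 * H 0ℚ + ∑[ t < suc n ] (w (suc n) (suc t) * H (fromℕ (suc t)))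
        ≡⟨ sym (∑-first (suc n) (λ t → w (suc n) t * H (fromℕ t))) ⟩
      alternatingSum (suc n) H ∎)
    where
    open ≡-Reasoning
    w = binomialWeight
    A = alternatingSum n H
    B = alternatingSum n (λ x → H (x + 1ℚ))
    A⁺ = ∑[ t < n ] (w n (suc t) * H (fromℕ t + 1ℚ))
    pascal : ∀ t → w n (suc t) * H (fromℕ t + 1ℚ) - w n t * H (fromℕ t + 1ℚ) ≡ w (suc n) (suc t) * H (fromℕ (suc t))
    pascal t = trans (solve 3 (λ a b h → a :* h :- b :* h := (a :- b) :* h) refl (w n (suc t)) (w n t) (H (fromℕ t + 1ℚ)))
                     (cong (_* H (fromℕ t + 1ℚ)) (sym (binomialWeight-pascal n t)))

  alternatingSum-vanishes : ∀ n {k H} → HasDegree≤ k H → k ℕ.< n → alternatingSum n H ≡ 0ℚ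
  alternatingSum-vanishes (suc n) {k} {H} dH k<n = begin
      alternatingSum (suc n) H                                      ≡⟨ alternatingSum-suc n H ⟩
      alternatingSum n H - alternatingSum n (λ x → H (x + 1ℚ))      ≡⟨ solve 2 (λ a b → a :- b := :- (b :- a)) refl (alternatingSum n H) (alternatingSum n (λ x → H (x + 1ℚ))) ⟩
      - (alternatingSum n (λ x → H (x + 1ℚ)) - alternatingSum n H)  ≡⟨ cong -_ (sym (alternatingSum-sub n (λ x → H (x + 1ℚ)) H)) ⟩
      - alternatingSum n (λ x → H (x + 1ℚ) - H x)                   ≡⟨ cong -_ (ΔH-vanishes k dH k<n) ⟩
      - 0ℚ                                                          ≡⟨⟩
      0ℚ                                                            ∎
    where
    open ≡-Reasoning
    ΔH-vanishes : ∀ k → HasDegree≤ k H → k ℕ.< suc n → alternatingSum n (λ x → H (x + 1ℚ) - H x) ≡ 0ℚ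
    ΔH-vanishes zero dH _ = begin
        alternatingSum n (λ x → H (x + 1ℚ) - H x)  ≡⟨ alternatingSum-cong n (λ x → trans (cong (_- H x) (deg0⇒const dH (x + 1ℚ) x)) (+-inverseʳ (H x))) ⟩
        alternatingSum n (λ _ → 0ℚ)                ≡⟨ ∑-cong (suc n) (λ t _ → *-comm (binomialWeight n t) 0ℚ) ⟩
        ∑[ t < suc n ] (0ℚ * binomialWeight n t)   ≡⟨ ∑-*ˡ (suc n) 0ℚ (binomialWeight n) ⟩
        0ℚ * ∑ (suc n) (binomialWeight n)          ≡⟨ *-zeroˡ (∑ (suc n) (binomialWeight n)) ⟩
        0ℚ                                         ∎
    ΔH-vanishes (suc k) dH (ℕ.s≤s k<n) = alternatingSum-vanishes n (deg-Δ dH) k<n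

module MarkovInequality where

  open import Data.Nat as ℕ using (ℕ; suc)
  import Data.Nat.Properties as ℕ
  open import Data.Nat.Combinatorics using (_C_)
  open import Data.Rational
  open import Data.Rational.Properties
  open import Data.Rational.Solver
  open import Data.Product using (_,_)
  open import Data.Integer using (+_; -<+)
  open import Relation.Nullary using (Dec; yes; no; contradiction)
  open import Relation.Binary.PropositionalEquality
  open import Relation.Binary.Definitions using (tri<; tri≈; tri>)
  open +-*-Solver
  open RationalArithmetic
  open PolynomialFunctions
  open BinomialCoefficients using (C-pos; C-central-max)
  open FiniteSums
  open AlternatingSums

  offset : ℕ → ℕ → ℚ
  offset M t = fromℕ t - fromℕ M

  den : ℕ → ℕ → ℚ
  den M t = fromℕ 4 * (offset M t * offset M t) - 1ℚ

  1≤fromℕ-gap : ∀ {m n} → m ℕ.< n → 1ℚ ≤ fromℕ n - fromℕ m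
  1≤fromℕ-gap {m} {n} m<n = ≤-byGap 1ℚ (fromℕ n - fromℕ m) (fromℕ n - (fromℕ m + 1ℚ)) (p≤q⇒0≤q-p (fromℕ-<⇒+1≤ m<n))
    (solve 2 (λ a b → a :- b := con 1ℚ :+ (a :- (b :+ con 1ℚ))) refl (fromℕ n) (fromℕ m))

  1≤p⇒1≤p*p : ∀ {p} → 1ℚ ≤ p → 1ℚ ≤ p * p
  1≤p⇒1≤p*p {p} 1≤p = ≤-trans 1≤p (subst (_≤ p * p) (*-identityʳ p) (*-monoˡ-≤-0≤ (≤-trans 0≤1 1≤p) 1≤p))

  1≤offset² : ∀ {M t} → t ≢ M → 1ℚ ≤ offset M t * offset M t
  1≤offset² {M} {t} t≢M with ℕ.<-cmp t M
  ... | tri< t<M _ _ = subst (1ℚ ≤_) (solve 2 (λ a b → (b :- a) :* (b :- a) := (a :- b) :* (a :- b)) refl (fromℕ t) (fromℕ M))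
                             (1≤p⇒1≤p*p (1≤fromℕ-gap t<M))
  ... | tri≈ _ t≡M _ = contradiction t≡M t≢M
  ... | tri> _ _ t>M = 1≤p⇒1≤p*p (1≤fromℕ-gap t>M)

  den-pos : ∀ {M t} → t ≢ M → 0ℚ < den M t
  den-pos {M} {t} t≢M = <-≤-trans 0<1 (≤-byGap 1ℚ (den M t) (fromℕ 4 * (u² - 1ℚ) + fromℕ 2)
      (+-mono-≤ (*-nonNeg (fromℕ-nonNeg 4) (p≤q⇒0≤q-p (1≤offset² t≢M))) (fromℕ-nonNeg 2))
      (solve 1 (λ v → con (fromℕ 4) :* v :- con 1ℚ := con 1ℚ :+ (con (fromℕ 4) :* (v :- con 1ℚ) :+ con (fromℕ 2))) refl u²))
    where
    u² = offset M t * offset M t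

  den-centre : ∀ M → den M M ≡ - 1ℚ
  den-centre M = solve 1 (λ c → con (fromℕ 4) :* ((c :- c) :* (c :- c)) :- con 1ℚ := con (- 1ℚ)) refl (fromℕ M)

  den≢0 : ∀ M t → den M t ≢ 0ℚ
  den≢0 M t with t ℕ.≟ M
  ... | yes refl = λ den≡0 → -1≢0 (trans (sym (den-centre M)) den≡0)
    where
    -1≢0 : - 1ℚ ≢ 0ℚ
    -1≢0 ()
  ... | no t≢M = ≢-sym (<⇒≢ (den-pos t≢M))

  partialFractions : ∀ {a} → a * (a + fromℕ 2) ≢ 0ℚ → (a * (a + fromℕ 2)) ⁻¹ ≡ ½ * (a ⁻¹ - (a + fromℕ 2) ⁻¹)
  partialFractions {a} ab≢0 = begin
      (a * b) ⁻¹                      ≡⟨ ⁻¹-distrib-* a≢0 b≢0 ⟩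
      a ⁻¹ * b ⁻¹                     ≡⟨ solve 3 (λ x y a → x :* y := con ½ :* (((a :+ con (fromℕ 2)) :- a) :* (x :* y))) refl (a ⁻¹) (b ⁻¹) a ⟩
      ½ * ((b - a) * (a ⁻¹ * b ⁻¹))   ≡⟨ cong (½ *_) (sym (⁻¹-difference a≢0 b≢0)) ⟩
      ½ * (a ⁻¹ - b ⁻¹)               ∎
    where
    open ≡-Reasoning
    b = a + fromℕ 2
    a≢0 : a ≢ 0ℚ
    a≢0 a≡0 = ab≢0 (trans (cong (_* b) a≡0) (*-zeroˡ b))
    b≢0 : b ≢ 0ℚ
    b≢0 b≡0 = ab≢0 (trans (cong (a *_) b≡0) (*-zeroʳ a))

  -- 1/(4u² - 1) = ½ (1/(2u - 1) - 1/(2u + 1)) telescopes to a non-positive total, from which the central term -1 is removed.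
  ∑-den⁻¹≤1 : ∀ M → ∑ (suc (M ℕ.+ M)) (except M (λ t → den M t ⁻¹)) ≤ 1ℚ
  ∑-den⁻¹≤1 M = begin
      ∑ T (except M den⁻¹)                          ≡⟨ solve 2 (λ s a → s := (a :+ s) :- a) refl (∑ T (except M den⁻¹)) (den⁻¹ M) ⟩
      (den⁻¹ M + ∑ T (except M den⁻¹)) - den⁻¹ M    ≡⟨ cong₂ _-_ (sym (∑-except T den⁻¹ M<T)) (cong _⁻¹ (den-centre M)) ⟩
      ∑ T den⁻¹ - (- 1ℚ) ⁻¹                         ≡⟨ cong₂ _-_ (∑-cong T (λ t _ → telescoping t)) (⁻¹-unique { - 1ℚ} { - 1ℚ} refl) ⟩
      ∑[ t < T ] (½ * (φ t - φ (suc t))) - - 1ℚ     ≡⟨ cong (_- - 1ℚ) (trans (∑-*ˡ T ½ _) (cong (½ *_) (∑-telescope T φ))) ⟩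
      ½ * (φ 0 - φ T) - - 1ℚ                        ≤⟨ +-monoˡ-≤ (- - 1ℚ) (*-monoˡ-≤-0≤ {½} (≤ᵇ⇒≤ _) φ0-φT≤0) ⟩
      ½ * 0ℚ - - 1ℚ                                 ≡⟨⟩
      1ℚ                                            ∎
    where
    open ≤-Reasoning
    T = suc (M ℕ.+ M)
    M<T : M ℕ.< T
    M<T = ℕ.s≤s (ℕ.m≤m+n M M)
    den⁻¹ : ℕ → ℚ
    den⁻¹ t = den M t ⁻¹
    a : ℕ → ℚ
    a t = fromℕ 2 * offset M t - 1ℚ
    φ : ℕ → ℚ
    φ t = a t ⁻¹
    telescoping : ∀ t → den⁻¹ t ≡ ½ * (φ t - φ (suc t))
    telescoping t = begin-equality
        den M t ⁻¹                        ≡⟨ cong _⁻¹ den≡ ⟩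
        (a t * (a t + fromℕ 2)) ⁻¹        ≡⟨ partialFractions {a t} (subst (_≢ 0ℚ) den≡ (den≢0 M t)) ⟩
        ½ * (a t ⁻¹ - (a t + fromℕ 2) ⁻¹) ≡⟨ cong (λ b → ½ * (a t ⁻¹ - b ⁻¹)) next ⟩
        ½ * (φ t - φ (suc t))             ∎
      where
      den≡ : den M t ≡ a t * (a t + fromℕ 2)
      den≡ = solve 1 (λ u → con (fromℕ 4) :* (u :* u) :- con 1ℚ := (con (fromℕ 2) :* u :- con 1ℚ) :* ((con (fromℕ 2) :* u :- con 1ℚ) :+ con (fromℕ 2)))
               refl (offset M t)
      next : a t + fromℕ 2 ≡ a (suc t)
      next = solve 2 (λ x c → con (fromℕ 2) :* (x :- c) :- con 1ℚ :+ con (fromℕ 2) := con (fromℕ 2) :* ((x :+ con 1ℚ) :- c) :- con 1ℚ)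
               refl (fromℕ t) (fromℕ M)
    φ0≤0 : φ 0 ≤ 0ℚ
    φ0≤0 = neg⇒⁻¹-nonPos (≤-<-trans (≤-byGap (a 0) (- 1ℚ) (fromℕ 2 * fromℕ M) (*-nonNeg (fromℕ-nonNeg 2) (fromℕ-nonNeg M))
             (solve 1 (λ c → con (- 1ℚ) := (con (fromℕ 2) :* (con 0ℚ :- c) :- con 1ℚ) :+ con (fromℕ 2) :* c) refl (fromℕ M))) (*<* -<+))
    0≤φT : 0ℚ ≤ φ T
    0≤φT = pos⇒⁻¹-nonNeg (<-≤-trans 0<1 (≤-byGap 1ℚ (a T) (fromℕ 2 * (offset M T - 1ℚ))
             (*-nonNeg (fromℕ-nonNeg 2) (p≤q⇒0≤q-p (1≤fromℕ-gap M<T)))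
             (solve 1 (λ v → con (fromℕ 2) :* v :- con 1ℚ := con 1ℚ :+ con (fromℕ 2) :* (v :- con 1ℚ)) refl (offset M T))))
    φ0-φT≤0 : φ 0 - φ T ≤ 0ℚ
    φ0-φT≤0 = +-mono-≤ φ0≤0 (neg-antimono-≤ 0≤φT)

  centralValue-bound : ∀ M {k H} c → HasDegree≤ k H → k ℕ.< M ℕ.+ M → 0ℚ ≤ c →
                       (∀ t → t ℕ.≤ M ℕ.+ M → t ≢ M → ∣ H (fromℕ t) ∣ ≤ c * den M t ⁻¹) →
                       ∣ H (fromℕ M) ∣ ≤ c
  centralValue-bound M {H = H} c dH k<2M 0≤c H-bound = *-cancelˡ-≤-0< b-pos (begin
      b * ∣ H (fromℕ M) ∣                    ≡⟨ cong (_* ∣ H (fromℕ M) ∣) (sym (∣binomialWeight∣ n M)) ⟩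
      ∣ w M ∣ * ∣ H (fromℕ M) ∣              ≡⟨ sym (∣p*q∣≡∣p∣*∣q∣ (w M) (H (fromℕ M))) ⟩
      ∣ f M ∣                                ≡⟨ cong ∣_∣ f-centre ⟩
      ∣ - ∑ T (except M f) ∣                 ≡⟨ ∣-p∣≡∣p∣ _ ⟩
      ∣ ∑ T (except M f) ∣                   ≤⟨ ∑-triangle T (except M f) ⟩
      ∑[ t < T ] ∣ except M f t ∣             ≤⟨ ∑-mono-≤ T term-bound ⟩
      ∑[ t < T ] (b * c * except M den⁻¹ t)   ≡⟨ ∑-*ˡ T (b * c) (except M den⁻¹) ⟩
      b * c * ∑ T (except M den⁻¹)           ≤⟨ *-monoˡ-≤-0≤ (*-nonNeg (<⇒≤ b-pos) 0≤c) (∑-den⁻¹≤1 M) ⟩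
      b * c * 1ℚ                             ≡⟨ *-identityʳ (b * c) ⟩
      b * c                                  ∎)
    where
    open ≤-Reasoning
    n = M ℕ.+ M
    T = suc n
    w = binomialWeight n
    f : ℕ → ℚ
    f t = w t * H (fromℕ t)
    den⁻¹ : ℕ → ℚ
    den⁻¹ t = den M t ⁻¹
    b = fromℕ (n C M)
    b-pos : 0ℚ < b
    b-pos = fromℕ-pos (C-pos (ℕ.m≤m+n M M))
    f-centre : f M ≡ - ∑ T (except M f)
    f-centre = begin-equality
        f M                                   ≡⟨ solve 2 (λ a s → a := (a :+ s) :- s) refl (f M) (∑ T (except M f)) ⟩
        (f M + ∑ T (except M f)) - ∑ T (except M f)
                                              ≡⟨ cong (_- ∑ T (except M f)) (sym (∑-except T f (ℕ.s≤s (ℕ.m≤m+n M M)))) ⟩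
        alternatingSum n H - ∑ T (except M f) ≡⟨ cong (_- ∑ T (except M f)) (alternatingSum-vanishes n dH k<2M) ⟩
        0ℚ - ∑ T (except M f)                 ≡⟨ +-identityˡ _ ⟩
        - ∑ T (except M f)                    ∎
    term-bound : ∀ t → t ℕ.< T → ∣ except M f t ∣ ≤ b * c * except M den⁻¹ t
    term-bound t (ℕ.s≤s t≤n) = by-cases (t ℕ.≟ M)
      where
      by-cases : Dec (t ≡ M) → ∣ except M f t ∣ ≤ b * c * except M den⁻¹ t
      by-cases (yes t≡M) = begin
          ∣ except M f t ∣          ≡⟨ cong ∣_∣ (except-≡ f t≡M) ⟩
          0ℚ                        ≡⟨ sym (*-zeroʳ (b * c)) ⟩
          b * c * 0ℚ                ≡⟨ cong (b * c *_) (sym (except-≡ den⁻¹ t≡M)) ⟩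
          b * c * except M den⁻¹ t  ∎
      by-cases (no t≢M) = begin
          ∣ except M f t ∣                   ≡⟨ cong ∣_∣ (except-≢ f t≢M) ⟩
          ∣ w t * H (fromℕ t) ∣              ≡⟨ ∣p*q∣≡∣p∣*∣q∣ (w t) (H (fromℕ t)) ⟩
          ∣ w t ∣ * ∣ H (fromℕ t) ∣          ≡⟨ cong (_* ∣ H (fromℕ t) ∣) (∣binomialWeight∣ n t) ⟩
          fromℕ (n C t) * ∣ H (fromℕ t) ∣    ≤⟨ *-monoʳ-≤-0≤ (0≤∣p∣ (H (fromℕ t))) (fromℕ-mono-≤ (C-central-max M t)) ⟩
          b * ∣ H (fromℕ t) ∣                ≤⟨ *-monoˡ-≤-0≤ (<⇒≤ b-pos) (H-bound t t≤n t≢M) ⟩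
          b * (c * den⁻¹ t)                  ≡⟨ sym (*-assoc b c (den⁻¹ t)) ⟩
          b * c * den⁻¹ t                    ≡⟨ cong (b * c *_) (sym (except-≢ den⁻¹ t≢M)) ⟩
          b * c * except M den⁻¹ t           ∎

  ⅛ : ℚ
  ⅛ = + 1 / 8

  quotient-bound : ∀ {d s g X} → 0ℚ < d → fromℕ 16 * d ≤ s → s * ∣ g ∣ ≤ X + X → ∣ g ∣ ≤ X * ⅛ * d ⁻¹
  quotient-bound {d} {s} {g} {X} 0<d 16d≤s s∣g∣≤2X = begin
      ∣ g ∣                  ≡⟨ sym (trans (cong (∣ g ∣ *_) (⁻¹-inverseʳ (≢-sym (<⇒≢ 0<d)))) (*-identityʳ ∣ g ∣)) ⟩
      ∣ g ∣ * (d * d ⁻¹)     ≡⟨ sym (*-assoc ∣ g ∣ d (d ⁻¹)) ⟩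
      ∣ g ∣ * d * d ⁻¹       ≤⟨ *-monoʳ-≤-0≤ (pos⇒⁻¹-nonNeg 0<d) d∣g∣≤X/8 ⟩
      X * ⅛ * d ⁻¹           ∎
    where
    open ≤-Reasoning
    d∣g∣≤X/8 : ∣ g ∣ * d ≤ X * ⅛
    d∣g∣≤X/8 = *-cancelˡ-≤-0< {fromℕ 16} (fromℕ-pos {16} (ℕ.s≤s ℕ.z≤n)) (begin
        fromℕ 16 * (∣ g ∣ * d)   ≡⟨ solve 3 (λ e g d → e :* (g :* d) := (e :* d) :* g) refl (fromℕ 16) ∣ g ∣ d ⟩
        fromℕ 16 * d * ∣ g ∣     ≤⟨ *-monoʳ-≤-0≤ (0≤∣p∣ g) 16d≤s ⟩
        s * ∣ g ∣                ≤⟨ s∣g∣≤2X ⟩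
        X + X                    ≡⟨ solve 1 (λ x → x :+ x := con (fromℕ 16) :* (x :* con ⅛)) refl X ⟩
        fromℕ 16 * (X * ⅛)       ∎)

  node : ℕ → ℕ → ℚ
  node M t = fromℕ 64 * (offset M t * offset M t)

  8≤node : ∀ {M t} → t ≢ M → fromℕ 8 ≤ node M t
  8≤node {M} {t} t≢M = ≤-byGap (fromℕ 8) (node M t) (fromℕ 64 * (u² - 1ℚ) + fromℕ 56)
      (+-mono-≤ (*-nonNeg (fromℕ-nonNeg 64) (p≤q⇒0≤q-p (1≤offset² t≢M))) (fromℕ-nonNeg 56))
      (solve 1 (λ v → con (fromℕ 64) :* v := con (fromℕ 8) :+ (con (fromℕ 64) :* (v :- con 1ℚ) :+ con (fromℕ 56))) refl u²)
    where
    u² = offset M t * offset M t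

  node≤64M² : ∀ {M t} → t ℕ.≤ M ℕ.+ M → node M t ≤ fromℕ 64 * (fromℕ M * fromℕ M)
  node≤64M² {M} {t} t≤2M = *-monoˡ-≤-0≤ (fromℕ-nonNeg 64) (≤-byGap (offset M t * offset M t) (fromℕ M * fromℕ M) ((fromℕ M + fromℕ M - fromℕ t) * fromℕ t)
    (*-nonNeg (p≤q⇒0≤q-p (subst (fromℕ t ≤_) (fromℕ-+ M M) (fromℕ-mono-≤ t≤2M))) (fromℕ-nonNeg t))
    (solve 2 (λ a b → b :* b := (a :- b) :* (a :- b) :+ (b :+ b :- a) :* a) refl (fromℕ t) (fromℕ M)))

  quotient-at-node : ∀ {M t} {F G : ℚ → ℚ} {X} → t ≢ M → (∀ z → F z ≡ F (fromℕ 8) + (z - fromℕ 8) * G z) →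
                     ∣ F (node M t) ∣ ≤ X → ∣ F (fromℕ 8) ∣ ≤ X → ∣ G (node M t) ∣ ≤ X * ⅛ * den M t ⁻¹
  quotient-at-node {M} {t} {F} {G} {X} t≢M F≡ Fz≤X F8≤X = quotient-bound {X = X} (den-pos t≢M) 16d≤s (begin
      s * ∣ G z ∣          ≡⟨ cong (_* ∣ G z ∣) (sym (0≤p⇒∣p∣≡p 0≤s)) ⟩
      ∣ s ∣ * ∣ G z ∣      ≡⟨ sym (∣p*q∣≡∣p∣*∣q∣ s (G z)) ⟩
      ∣ s * G z ∣          ≡⟨ cong ∣_∣ (trans (solve 2 (λ a b → b := (a :+ b) :- a) refl (F e8) (s * G z)) (cong (_- F e8) (sym (F≡ z)))) ⟩
      ∣ F z - F e8 ∣       ≤⟨ ∣p-q∣≤∣p∣+∣q∣ (F z) (F e8) ⟩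
      ∣ F z ∣ + ∣ F e8 ∣   ≤⟨ +-mono-≤ Fz≤X F8≤X ⟩
      X + X                ∎)
    where
    open ≤-Reasoning
    e8 = fromℕ 8
    z = node M t
    s = z - e8
    s≡ : s ≡ fromℕ 16 * den M t + e8
    s≡ = solve 1 (λ v → con (fromℕ 64) :* v :- con (fromℕ 8) := con (fromℕ 16) :* (con (fromℕ 4) :* v :- con 1ℚ) :+ con (fromℕ 8))
           refl (offset M t * offset M t)
    16d≤s : fromℕ 16 * den M t ≤ s
    16d≤s = ≤-byGap _ s e8 (fromℕ-nonNeg 8) s≡
    0≤s : 0ℚ ≤ s
    0≤s = ≤-trans (*-nonNeg (fromℕ-nonNeg 16) (<⇒≤ (den-pos t≢M))) 16d≤s

  -- Write F z = F 8 + (z - 8) G z. Then H x = G (64 (x - M)²) has degree < 2M, so its 2M-th difference vanishes and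
  -- bounds H(M) = G(0) by the values H(t) = G(node M t), each at most X / (8 (4u² - 1)) because node M t - 8 ≥ 16 (4u² - 1).
  discreteMarkov : ∀ m {F} X → HasDegree≤ (suc m) F → ∣ F (fromℕ 8) ∣ ≤ X →
                   (∀ t → t ℕ.≤ suc m ℕ.+ suc m → t ≢ suc m → ∣ F (node (suc m) t) ∣ ≤ X) →
                   ∣ F 0ℚ - F (fromℕ 8) ∣ ≤ X
  discreteMarkov m {F} X dF F8≤X F-nodes≤X with factorTheorem (fromℕ 8) dF
  ... | G , dG , F≡ = begin
      ∣ F 0ℚ - F e8 ∣              ≡⟨ cong ∣_∣ F0-F8 ⟩
      ∣ (0ℚ - e8) * G 0ℚ ∣         ≡⟨ ∣p*q∣≡∣p∣*∣q∣ (0ℚ - e8) (G 0ℚ) ⟩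
      e8 * ∣ G 0ℚ ∣                ≡⟨ cong (λ z → e8 * ∣ G z ∣) (sym node-centre) ⟩
      e8 * ∣ H (fromℕ M) ∣         ≤⟨ *-monoˡ-≤-0≤ (fromℕ-nonNeg 8) H-centre ⟩
      e8 * (X * ⅛)                 ≡⟨ solve 1 (λ x → con (fromℕ 8) :* (x :* con ⅛) := x) refl X ⟩
      X                            ∎
    where
    open ≤-Reasoning
    M = suc m
    e8 = fromℕ 8
    H : ℚ → ℚ
    H x = G (fromℕ 64 * ((x - fromℕ M) * (x - fromℕ M)))
    dH : HasDegree≤ (m ℕ.* 2) H
    dH = deg-∘ (ext (λ x → solve 2 (λ c x → con (fromℕ 64) :* ((con 1ℚ :* x :+ :- c) :* (con 1ℚ :* x :+ :- c))
                                          := con (fromℕ 64) :* ((x :- c) :* (x :- c))) refl (fromℕ M) x)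
                    (scale (fromℕ 64) (deg-* (deg-affine 1ℚ (- fromℕ M)) (deg-affine 1ℚ (- fromℕ M))))) dG
    2m<2M : m ℕ.* 2 ℕ.< M ℕ.+ M
    2m<2M = subst (ℕ._< M ℕ.+ M) (sym (trans (ℕ.*-comm m 2) (cong (m ℕ.+_) (ℕ.+-identityʳ m))))
              (ℕ.s≤s (ℕ.+-monoʳ-≤ m (ℕ.n≤1+n m)))
    0≤X : 0ℚ ≤ X
    0≤X = ≤-trans (0≤∣p∣ (F e8)) F8≤X
    F0-F8 : F 0ℚ - F e8 ≡ (0ℚ - e8) * G 0ℚ
    F0-F8 = trans (cong (_- F e8) (F≡ 0ℚ)) (solve 3 (λ a b c → (a :+ b :* c) :- a := b :* c) refl (F e8) (0ℚ - e8) (G 0ℚ))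
    node-centre : node M M ≡ 0ℚ
    node-centre = solve 1 (λ c → con (fromℕ 64) :* ((c :- c) :* (c :- c)) := con 0ℚ) refl (fromℕ M)
    H-centre : ∣ H (fromℕ M) ∣ ≤ X * ⅛
    H-centre = centralValue-bound M (X * ⅛) dH 2m<2M (*-nonNeg 0≤X (≤ᵇ⇒≤ _))
                 (λ t t≤2M t≢M → quotient-at-node t≢M F≡ (F-nodes≤X t t≤2M t≢M) F8≤X)

module CubeAverages where

  open import Data.Nat as ℕ using (ℕ; zero; suc)
  import Data.Nat.Properties as ℕ
  open import Data.Bool using (Bool; true; false; not)
  open import Data.Fin as Fin using (Fin)
  open import Data.List using (List; []; _∷_; length)
  open import Data.List.Relation.Unary.All using (All; []; _∷_)
  open import Data.List.Relation.Unary.Unique.Propositional using (Unique; []; _∷_)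
  open import Data.Rational
  open import Data.Rational.Properties
  open import Data.Rational.Solver
  open import Algebra.Definitions.RawSemiring +-*-rawSemiring using (_^_)
  open import Data.Product using (_×_; _,_)
  open import Data.Unit using (⊤)
  open import Data.Empty using (⊥-elim)
  open import Relation.Nullary using (yes; no)
  open import Relation.Binary.PropositionalEquality
  open +-*-Solver
  open RationalArithmetic
  open PolynomialFunctions

  Point : ℕ → Set
  Point n = Fin n → Bool

  module _ {n : ℕ} where

    flipAt-≢ : ∀ (x : Point n) {i j} → i ≢ j → flipAt x i j ≡ x j
    flipAt-≢ x {i} {j} i≢j with i Fin.≟ j
    ... | yes i≡j = ⊥-elim (i≢j i≡j)
    ... | no _ = refl

    -- The expectation of G at x with each coordinate of S flipped independently with probability r.
    average : ℚ → (Point n → ℚ) → Point n → List (Fin n) → ℚ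
    average r G x [] = G x
    average r G x (i ∷ S) = (1ℚ - r) * average r G x S + r * average r G (flipAt x i) S

    AllFlips : (Point n → Set) → Point n → List (Fin n) → Set
    AllFlips P x [] = P x
    AllFlips P x (i ∷ S) = AllFlips P x S × AllFlips P (flipAt x i) S

    NonemptyFlips : (Point n → Set) → Point n → List (Fin n) → Set
    NonemptyFlips P x [] = ⊤
    NonemptyFlips P x (i ∷ S) = NonemptyFlips P x S × AllFlips P (flipAt x i) S

    AllFlips-map : ∀ {P Q : Point n → Set} → (∀ y → P y → Q y) → ∀ x S → AllFlips P x S → AllFlips Q x S
    AllFlips-map P⇒Q x [] p = P⇒Q x p
    AllFlips-map P⇒Q x (i ∷ S) (p , p′) = AllFlips-map P⇒Q x S p , AllFlips-map P⇒Q (flipAt x i) S p′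

    NonemptyFlips-map : ∀ {P Q : Point n → Set} → (∀ y → P y → Q y) → ∀ x S → NonemptyFlips P x S → NonemptyFlips Q x S
    NonemptyFlips-map P⇒Q x [] _ = _
    NonemptyFlips-map P⇒Q x (i ∷ S) (p , p′) = NonemptyFlips-map P⇒Q x S p , AllFlips-map P⇒Q (flipAt x i) S p′

    average-cong : ∀ r {G H : Point n → ℚ} x S → (∀ y → G y ≡ H y) → average r G x S ≡ average r H x S
    average-cong r x [] G≗H = G≗H x
    average-cong r x (i ∷ S) G≗H = cong₂ (λ a b → (1ℚ - r) * a + r * b) (average-cong r x S G≗H) (average-cong r (flipAt x i) S G≗H)

    average-+ : ∀ r (G H : Point n → ℚ) x S → average r (λ y → G y + H y) x S ≡ average r G x S + average r H x S
    average-+ r G H x [] = refl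
    average-+ r G H x (i ∷ S) = trans (cong₂ (λ a b → (1ℚ - r) * a + r * b) (average-+ r G H x S) (average-+ r G H (flipAt x i) S))
      (solve 5 (λ r a b c d → (con 1ℚ :- r) :* (a :+ b) :+ r :* (c :+ d) := ((con 1ℚ :- r) :* a :+ r :* c) :+ ((con 1ℚ :- r) :* b :+ r :* d))
        refl r (average r G x S) (average r H x S) (average r G (flipAt x i) S) (average r H (flipAt x i) S))

    average-0 : ∀ r x S → average r (λ _ → 0ℚ) x S ≡ 0ℚ
    average-0 r x [] = refl
    average-0 r x (i ∷ S) = trans (cong₂ (λ a b → (1ℚ - r) * a + r * b) (average-0 r x S) (average-0 r (flipAt x i) S))
      (solve 1 (λ r → (con 1ℚ :- r) :* con 0ℚ :+ r :* con 0ℚ := con 0ℚ) refl r)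

    average-at-0 : ∀ (G : Point n → ℚ) x S → average 0ℚ G x S ≡ G x
    average-at-0 G x [] = refl
    average-at-0 G x (i ∷ S) = trans (cong (λ a → (1ℚ - 0ℚ) * a + 0ℚ * average 0ℚ G (flipAt x i) S) (average-at-0 G x S))
      (solve 2 (λ a b → (con 1ℚ :- con 0ℚ) :* a :+ con 0ℚ :* b := a) refl (G x) (average 0ℚ G (flipAt x i) S))

    average-pull : ∀ r (h : Bool → ℚ) (G : Point n → ℚ) i x S → All (i ≢_) S →
                   average r (λ y → h (y i) * G y) x S ≡ h (x i) * average r G x S
    average-pull r h G i x [] _ = refl
    average-pull r h G i x (j ∷ S) (i≢j ∷ i∉S) = trans
      (cong₂ (λ a b → (1ℚ - r) * a + r * b) (average-pull r h G i x S i∉S)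
        (trans (average-pull r h G i (flipAt x j) S i∉S) (cong (λ v → h v * average r G (flipAt x j) S) (flipAt-≢ x (≢-sym i≢j)))))
      (solve 4 (λ r c a b → (con 1ℚ :- r) :* (c :* a) :+ r :* (c :* b) := c :* ((con 1ℚ :- r) :* a :+ r :* b))
        refl r (h (x i)) (average r G x S) (average r G (flipAt x j) S))

    average-ignores : ∀ r (G : Point n → ℚ) i → (∀ y y′ → (∀ j → j ≢ i → y j ≡ y′ j) → G y ≡ G y′) →
                      ∀ x x′ S → (∀ j → j ≢ i → x j ≡ x′ j) → average r G x S ≡ average r G x′ S
    average-ignores r G i G-ignores x x′ [] x≈x′ = G-ignores x x′ x≈x′
    average-ignores r G i G-ignores x x′ (j ∷ S) x≈x′ = cong₂ (λ a b → (1ℚ - r) * a + r * b)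
      (average-ignores r G i G-ignores x x′ S x≈x′) (average-ignores r G i G-ignores (flipAt x j) (flipAt x′ j) S flips≈)
      where
      flips≈ : ∀ k → k ≢ i → flipAt x j k ≡ flipAt x′ j k
      flips≈ k k≢i with j Fin.≟ k
      ... | yes _ = cong not (x≈x′ k k≢i)
      ... | no _ = x≈x′ k k≢i

    occurs : Fin n → List (Fin n) → Bool
    occurs i [] = false
    occurs i (j ∷ vs) with i Fin.≟ j
    ... | yes _ = true
    ... | no _ = occurs i vs

    removeAll : Fin n → List (Fin n) → List (Fin n)
    removeAll i [] = []
    removeAll i (j ∷ vs) with i Fin.≟ j
    ... | yes _ = removeAll i vs
    ... | no _ = j ∷ removeAll i vs

    length-removeAll : ∀ i vs → length (removeAll i vs) ℕ.≤ length vs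
    length-removeAll i [] = ℕ.z≤n
    length-removeAll i (j ∷ vs) with i Fin.≟ j
    ... | yes _ = ℕ.m≤n⇒m≤1+n (length-removeAll i vs)
    ... | no _ = ℕ.s≤s (length-removeAll i vs)

    length-removeAll-< : ∀ i vs → occurs i vs ≡ true → length (removeAll i vs) ℕ.< length vs
    length-removeAll-< i (j ∷ vs) i∈vs with i Fin.≟ j
    ... | yes _ = ℕ.s≤s (length-removeAll i vs)
    ... | no _ = ℕ.s≤s (length-removeAll-< i vs i∈vs)

    evalMono-absent : ∀ i vs → occurs i vs ≡ false → ∀ c (y : Point n) → evalMono (c , vs) y ≡ evalMono (c , removeAll i vs) y
    evalMono-absent i [] _ c y = refl
    evalMono-absent i (j ∷ vs) i∉vs c y with i Fin.≟ j
    ... | no _ = cong (boolToℚ (y j) *_) (evalMono-absent i vs i∉vs c y)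

    -- Variables are Boolean, so repeated occurrences of xᵢ collapse to one.
    evalMono-present : ∀ i vs → occurs i vs ≡ true → ∀ c (y : Point n) →
                       evalMono (c , vs) y ≡ boolToℚ (y i) * evalMono (c , removeAll i vs) y
    evalMono-present i (j ∷ vs) i∈vs c y with i Fin.≟ j
    ... | no _ = trans (cong (boolToℚ (y j) *_) (evalMono-present i vs i∈vs c y))
      (solve 3 (λ a b c → a :* (b :* c) := b :* (a :* c)) refl (boolToℚ (y j)) (boolToℚ (y i)) (evalMono (c , removeAll i vs) y))
    ... | yes refl with occurs i vs in i∈?vs
    ...   | true = trans (cong (boolToℚ (y i) *_) (evalMono-present i vs i∈?vs c y))
                     (trans (sym (*-assoc (boolToℚ (y i)) (boolToℚ (y i)) _)) (cong (_* evalMono (c , removeAll i vs) y) (idempotent (y i))))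
      where
      idempotent : ∀ b → boolToℚ b * boolToℚ b ≡ boolToℚ b
      idempotent true = refl
      idempotent false = refl
    ...   | false = cong (boolToℚ (y i) *_) (evalMono-absent i vs i∈?vs c y)

    evalMono-ignores : ∀ i vs → occurs i vs ≡ false → ∀ c (y y′ : Point n) → (∀ j → j ≢ i → y j ≡ y′ j) →
                       evalMono (c , vs) y ≡ evalMono (c , vs) y′
    evalMono-ignores i [] _ c y y′ y≈y′ = refl
    evalMono-ignores i (j ∷ vs) i∉vs c y y′ y≈y′ with i Fin.≟ j
    ... | no i≢j = cong₂ _*_ (cong boolToℚ (y≈y′ j (≢-sym i≢j))) (evalMono-ignores i vs i∉vs c y y′ y≈y′)

    average-monomial-degree : ∀ S → Unique S → ∀ (x : Point n) c vs →
                              HasDegree≤ (length vs) (λ r → average r (evalMono (c , vs)) x S)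
    average-monomial-degree [] _ x c vs = const (evalMono (c , vs) x)
    average-monomial-degree (i ∷ S) (i∉S ∷ uS) x c vs with occurs i vs in i∈?vs
    ... | true = weaken (length-removeAll-< i vs i∈?vs)
                   (ext expand (add (weaken (ℕ.n≤1+n _) (scale b (deg x))) (mulX (deg-sub (scale b′ (deg x′)) (scale b (deg x))))))
      where
      vs′ = removeAll i vs
      x′ = flipAt x i
      b b′ : ℚ
      b = boolToℚ (x i)
      b′ = boolToℚ (x′ i)
      deg : ∀ z → HasDegree≤ (length vs′) (λ r → average r (evalMono (c , vs′)) z S)
      deg = λ z → average-monomial-degree S uS z c vs′
      A : Point n → ℚ → ℚ
      A z r = average r (evalMono (c , vs′)) z S
      factor : ∀ r z → average r (evalMono (c , vs)) z S ≡ boolToℚ (z i) * A z r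
      factor r z = trans (average-cong r z S (evalMono-present i vs i∈?vs c)) (average-pull r boolToℚ (evalMono (c , vs′)) i z S i∉S)
      expand : ∀ r → b * A x r + r * (b′ * A x′ r - b * A x r) ≡ average r (evalMono (c , vs)) x (i ∷ S)
      expand r = trans (solve 5 (λ r p q a a′ → p :* a :+ r :* (q :* a′ :- p :* a) := (con 1ℚ :- r) :* (p :* a) :+ r :* (q :* a′)) refl r b b′ (A x r) (A x′ r))
                       (sym (cong₂ (λ a a′ → (1ℚ - r) * a + r * a′) (factor r x) (factor r x′)))
    ... | false = ext expand (average-monomial-degree S uS x c vs)
      where
      G = evalMono (c , vs)
      expand : ∀ r → average r G x S ≡ average r G x (i ∷ S)
      expand r = trans (solve 2 (λ r a → a := (con 1ℚ :- r) :* a :+ r :* a) refl r (average r G x S))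
        (cong (λ a → (1ℚ - r) * average r G x S + r * a)
          (average-ignores r G i (evalMono-ignores i vs i∈?vs c) x (flipAt x i) S (λ j j≢i → sym (flipAt-≢ x (≢-sym j≢i)))))

    average-degree : ∀ S → Unique S → ∀ (x : Point n) (p : Poly n) d → degree p ℕ.≤ d →
                     HasDegree≤ d (λ r → average r (eval p) x S)
    average-degree S uS x [] d _ = ext (λ r → sym (average-0 r x S)) (const 0ℚ)
    average-degree S uS x ((c , vs) ∷ p) d deg≤d = ext (λ r → sym (average-+ r (evalMono (c , vs)) (eval p) x S))
      (add (weaken (ℕ.m⊔n≤o⇒m≤o (length vs) (degree p) deg≤d) (average-monomial-degree S uS x c vs))
           (average-degree S uS x p d (ℕ.m⊔n≤o⇒n≤o (length vs) (degree p) deg≤d)))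

  ^-nonNeg : ∀ {p} n → 0ℚ ≤ p → 0ℚ ≤ p ^ n
  ^-nonNeg zero _ = 0≤1
  ^-nonNeg (suc n) 0≤p = *-nonNeg 0≤p (^-nonNeg n 0≤p)

  ∣convex∣≤ : ∀ {r} a b → 0ℚ ≤ r → r ≤ 1ℚ → ∣ (1ℚ - r) * a + r * b ∣ ≤ (1ℚ - r) * ∣ a ∣ + r * ∣ b ∣
  ∣convex∣≤ {r} a b 0≤r r≤1 = ≤-trans (∣p+q∣≤∣p∣+∣q∣ ((1ℚ - r) * a) (r * b))
    (≤-reflexive (cong₂ _+_ (trans (∣p*q∣≡∣p∣*∣q∣ (1ℚ - r) a) (cong (_* ∣ a ∣) (0≤p⇒∣p∣≡p (p≤q⇒0≤q-p r≤1))))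
                            (trans (∣p*q∣≡∣p∣*∣q∣ r b) (cong (_* ∣ b ∣) (0≤p⇒∣p∣≡p 0≤r)))))

  module _ {n : ℕ} {r : ℚ} (0≤r : 0ℚ ≤ r) (r≤1 : r ≤ 1ℚ) (G : Point n → ℚ) (c : ℚ) where

    average-bound : ∀ x S → AllFlips (λ y → ∣ G y ∣ ≤ c) x S → ∣ average r G x S ∣ ≤ c
    average-bound x [] G≤c = G≤c
    average-bound x (i ∷ S) (G≤c , G′≤c) = begin
        ∣ (1ℚ - r) * average r G x S + r * average r G (flipAt x i) S ∣
          ≤⟨ ∣convex∣≤ _ _ 0≤r r≤1 ⟩
        (1ℚ - r) * ∣ average r G x S ∣ + r * ∣ average r G (flipAt x i) S ∣
          ≤⟨ +-mono-≤ (*-monoˡ-≤-0≤ (p≤q⇒0≤q-p r≤1) (average-bound x S G≤c)) (*-monoˡ-≤-0≤ 0≤r (average-bound (flipAt x i) S G′≤c)) ⟩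
        (1ℚ - r) * c + r * c
          ≡⟨ solve 2 (λ r c → (con 1ℚ :- r) :* c :+ r :* c := c) refl r c ⟩
        c ∎
      where open ≤-Reasoning

    -- Only the unflipped point escapes the bound c, and it survives with probability (1 - r)^|S|.
    average-bound-nonempty : 0ℚ ≤ c → ∀ x S → NonemptyFlips (λ y → ∣ G y ∣ ≤ c) x S →
                             ∣ average r G x S ∣ ≤ (1ℚ - r) ^ length S * ∣ G x ∣ + c
    average-bound-nonempty 0≤c x [] _ = ≤-byGap ∣ G x ∣ (1ℚ * ∣ G x ∣ + c) c 0≤c (cong (_+ c) (*-identityˡ ∣ G x ∣))
    average-bound-nonempty 0≤c x (i ∷ S) (G≤c , G′≤c) = begin
        ∣ (1ℚ - r) * average r G x S + r * average r G (flipAt x i) S ∣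
          ≤⟨ ∣convex∣≤ _ _ 0≤r r≤1 ⟩
        (1ℚ - r) * ∣ average r G x S ∣ + r * ∣ average r G (flipAt x i) S ∣
          ≤⟨ +-mono-≤ (*-monoˡ-≤-0≤ (p≤q⇒0≤q-p r≤1) (average-bound-nonempty 0≤c x S G≤c))
                      (*-monoˡ-≤-0≤ 0≤r (average-bound (flipAt x i) S G′≤c)) ⟩
        (1ℚ - r) * ((1ℚ - r) ^ length S * ∣ G x ∣ + c) + r * c
          ≡⟨ solve 4 (λ r p g c → (con 1ℚ :- r) :* (p :* g :+ c) :+ r :* c := ((con 1ℚ :- r) :* p) :* g :+ c)
                     refl r ((1ℚ - r) ^ length S) ∣ G x ∣ c ⟩
        (1ℚ - r) ^ length (i ∷ S) * ∣ G x ∣ + c ∎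
      where open ≤-Reasoning

module ApproximationBound where

  open import Data.Nat as ℕ using (ℕ; zero; suc)
  import Data.Nat.Properties as ℕ
  open import Data.Fin using (Fin)
  open import Data.List using (List; length)
  open import Data.List.Relation.Unary.Unique.Propositional using (Unique)
  open import Data.Integer using (+_)
  open import Data.Rational
  open import Data.Rational.Properties
  open import Data.Rational.Solver
  open import Algebra.Definitions.RawSemiring +-*-rawSemiring using (_^_)
  open import Data.Empty using (⊥-elim)
  open import Relation.Nullary using (¬_; yes; no; contradiction)
  open import Relation.Binary.PropositionalEquality
  open +-*-Solver
  open RationalArithmetic
  open PolynomialFunctions
  open MarkovInequality
  open CubeAverages

  ⅓ ⅑ : ℚ
  ⅓ = + 1 / 3
  ⅑ = + 1 / 9

  bernoulli : ∀ N {r} → 0ℚ ≤ r → r ≤ 1ℚ → (1ℚ - r) ^ N * (1ℚ + fromℕ N * r) ≤ 1ℚ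
  bernoulli zero {r} _ _ = ≤-reflexive (solve 1 (λ r → con 1ℚ :* (con 1ℚ :+ con 0ℚ :* r) := con 1ℚ) refl r)
  bernoulli (suc N) {r} 0≤r r≤1 = ≤-trans
    (≤-byGap _ _ (P * ((fromℕ N + 1ℚ) * (r * r))) (*-nonNeg (^-nonNeg N (p≤q⇒0≤q-p r≤1)) (*-nonNeg (fromℕ-nonNeg (suc N)) (*-nonNeg 0≤r 0≤r)))
      (solve 3 (λ p n r → p :* (con 1ℚ :+ n :* r) := ((con 1ℚ :- r) :* p) :* (con 1ℚ :+ (n :+ con 1ℚ) :* r) :+ p :* ((n :+ con 1ℚ) :* (r :* r)))
        refl P (fromℕ N) r))
    (bernoulli N 0≤r r≤1)
    where
    P = (1ℚ - r) ^ N

  module _ {N : ℕ} (0<N : 0 ℕ.< N) {z : ℚ} (0≤z : 0ℚ ≤ z) (z≤N : z ≤ fromℕ N) where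

    private
      N⁻¹ = fromℕ N ⁻¹

      N*N⁻¹≡1 : fromℕ N * N⁻¹ ≡ 1ℚ
      N*N⁻¹≡1 = ⁻¹-inverseʳ (≢-sym (<⇒≢ (fromℕ-pos 0<N)))

    0≤z/N : 0ℚ ≤ z * N⁻¹
    0≤z/N = *-nonNeg 0≤z (pos⇒⁻¹-nonNeg (fromℕ-pos 0<N))

    z/N≤1 : z * N⁻¹ ≤ 1ℚ
    z/N≤1 = ≤-trans (*-monoʳ-≤-0≤ (pos⇒⁻¹-nonNeg (fromℕ-pos 0<N)) z≤N) (≤-reflexive N*N⁻¹≡1)

    -- Bernoulli gives (1 - z/N)ᴺ ≤ 1/(1 + z), which is ≤ 1/9 once z ≥ 8.
    decay : fromℕ 8 ≤ z → (1ℚ - z * N⁻¹) ^ N ≤ ⅑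
    decay 8≤z = *-cancelˡ-≤-0< {fromℕ 9} (fromℕ-pos {9} (ℕ.s≤s ℕ.z≤n)) (begin
        fromℕ 9 * P          ≤⟨ *-monoʳ-≤-0≤ (^-nonNeg N (p≤q⇒0≤q-p z/N≤1))
                                  (≤-byGap (fromℕ 9) (1ℚ + z) (z - fromℕ 8) (p≤q⇒0≤q-p 8≤z) (solve 1 (λ z → con 1ℚ :+ z := con (fromℕ 9) :+ (z :- con (fromℕ 8))) refl z)) ⟩
        (1ℚ + z) * P         ≡⟨ *-comm (1ℚ + z) P ⟩
        P * (1ℚ + z)         ≡⟨ cong (λ v → P * (1ℚ + v)) (sym N*z/N≡z) ⟩
        P * (1ℚ + fromℕ N * (z * N⁻¹)) ≤⟨ bernoulli N 0≤z/N z/N≤1 ⟩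
        1ℚ                   ≡⟨⟩
        fromℕ 9 * ⅑          ∎)
      where
      open ≤-Reasoning
      P = (1ℚ - z * N⁻¹) ^ N
      N*z/N≡z : fromℕ N * (z * N⁻¹) ≡ z
      N*z/N≡z = trans (solve 3 (λ a b c → a :* (b :* c) := b :* (a :* c)) refl (fromℕ N) z N⁻¹) (trans (cong (z *_) N*N⁻¹≡1) (*-identityʳ z))

  g≰2[g⅑+⅓] : ∀ {g} → 1ℚ ≤ g → ¬ g ≤ (g * ⅑ + ⅓) + (g * ⅑ + ⅓)
  g≰2[g⅑+⅓] {g} 1≤g g≤2X = ¬0≤-⅑ (≤-byGap 0ℚ (- ⅑) (((g * ⅑ + ⅓) + (g * ⅑ + ⅓) - g) + (+ 7 / 9) * (g - 1ℚ))
      (+-mono-≤ (p≤q⇒0≤q-p g≤2X) (*-nonNeg {+ 7 / 9} (≤ᵇ⇒≤ _) (p≤q⇒0≤q-p 1≤g)))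
      (solve 1 (λ g → con (- ⅑) := con 0ℚ :+ (((g :* con ⅑ :+ con ⅓) :+ (g :* con ⅑ :+ con ⅓) :- g) :+ con (+ 7 / 9) :* (g :- con 1ℚ)))
        refl g))
    where
    ¬0≤-⅑ : ¬ 0ℚ ≤ - ⅑
    ¬0≤-⅑ 0≤-⅑ with ≤⇒≤ᵇ 0≤-⅑
    ... | ()

  module _ {n : ℕ} (p : Poly n) (x : Point n) (S : List (Fin n))
           (1≤∣p∣ : 1ℚ ≤ ∣ eval p x ∣) (small : NonemptyFlips (λ y → ∣ eval p y ∣ ≤ ⅓) x S) where

    private
      N = length S
      g = ∣ eval p x ∣

      E : ℚ → ℚ
      E r = average r (eval p) x S

      E-bound : ∀ {r} → 0ℚ ≤ r → r ≤ 1ℚ → ∣ E r ∣ ≤ (1ℚ - r) ^ N * g + ⅓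
      E-bound 0≤r r≤1 = average-bound-nonempty 0≤r r≤1 (eval p) ⅓ (≤ᵇ⇒≤ _) x S small

      E-0 : E 0ℚ ≡ eval p x
      E-0 = average-at-0 (eval p) x S

    constant-impossible : 0 ℕ.< N → ¬ HasDegree≤ 0 E
    constant-impossible 0<N dE = contradiction (begin
        1ℚ                        ≤⟨ 1≤∣p∣ ⟩
        ∣ eval p x ∣              ≡⟨ cong ∣_∣ (trans (sym E-0) (deg0⇒const dE 0ℚ 1ℚ)) ⟩
        ∣ E 1ℚ ∣                  ≤⟨ E-bound 0≤1 ≤-refl ⟩
        (1ℚ - 1ℚ) ^ N * g + ⅓     ≡⟨ cong (λ v → v * g + ⅓) (0^N 0<N) ⟩
        0ℚ * g + ⅓                ≡⟨ cong (_+ ⅓) (*-zeroˡ g) ⟩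
        ⅓                         ∎) ¬1≤⅓
      where
      open ≤-Reasoning
      0^N : ∀ {k} → 0 ℕ.< k → 0ℚ ^ k ≡ 0ℚ
      0^N {suc k} _ = *-zeroˡ (0ℚ ^ k)
      ¬1≤⅓ : ¬ 1ℚ ≤ ⅓
      ¬1≤⅓ 1≤⅓ with ≤⇒≤ᵇ 1≤⅓
      ... | ()

    highDegree-impossible : ∀ m → 64 ℕ.* (suc m ℕ.* suc m) ℕ.< N → ¬ HasDegree≤ (suc m) E
    highDegree-impossible m 64M²<N dE = g≰2[g⅑+⅓] 1≤∣p∣ g≤2X
      where
      open ≤-Reasoning
      M = suc m
      0<N : 0 ℕ.< N
      0<N = ℕ.≤-<-trans ℕ.z≤n 64M²<N
      F : ℚ → ℚ
      F z = E (z * fromℕ N ⁻¹)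
      X = g * ⅑ + ⅓
      F-bound : ∀ {z} → fromℕ 8 ≤ z → z ≤ fromℕ N → ∣ F z ∣ ≤ X
      F-bound {z} 8≤z z≤N = begin
          ∣ F z ∣                                ≤⟨ E-bound (0≤z/N 0<N 0≤z z≤N) (z/N≤1 0<N 0≤z z≤N) ⟩
          (1ℚ - z * fromℕ N ⁻¹) ^ N * g + ⅓     ≤⟨ +-monoˡ-≤ ⅓ (*-monoʳ-≤-0≤ (0≤∣p∣ (eval p x)) (decay 0<N 0≤z z≤N 8≤z)) ⟩
          ⅑ * g + ⅓                              ≡⟨ cong (_+ ⅓) (*-comm ⅑ g) ⟩
          X                                      ∎
        where
        0≤z : 0ℚ ≤ z
        0≤z = ≤-trans (fromℕ-nonNeg 8) 8≤z
      64M²≤N : fromℕ 64 * (fromℕ M * fromℕ M) ≤ fromℕ N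
      64M²≤N = subst (_≤ fromℕ N) (trans (fromℕ-* 64 (M ℕ.* M)) (cong (fromℕ 64 *_) (fromℕ-* M M))) (fromℕ-mono-≤ (ℕ.<⇒≤ 64M²<N))
      8≤N : fromℕ 8 ≤ fromℕ N
      8≤N = fromℕ-mono-≤ (ℕ.≤-trans (ℕ.m≤m+n 8 56) (ℕ.≤-trans (ℕ.*-monoʳ-≤ 64 (ℕ.s≤s ℕ.z≤n)) (ℕ.<⇒≤ 64M²<N)))
      node-bound : ∀ t → t ℕ.≤ M ℕ.+ M → t ≢ M → ∣ F (node M t) ∣ ≤ X
      node-bound t t≤2M t≢M = F-bound (8≤node t≢M) (≤-trans (node≤64M² {M} t≤2M) 64M²≤N)
      F-0 : F 0ℚ ≡ eval p x
      F-0 = trans (cong E (*-zeroˡ (fromℕ N ⁻¹))) E-0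
      F8≤X : ∣ F (fromℕ 8) ∣ ≤ X
      F8≤X = F-bound ≤-refl 8≤N
      g≤2X : g ≤ X + X
      g≤2X = begin
          g                                        ≡⟨ cong ∣_∣ (sym F-0) ⟩
          ∣ F 0ℚ ∣                                 ≡⟨ cong ∣_∣ (solve 2 (λ a b → a := (a :- b) :+ b) refl (F 0ℚ) (F (fromℕ 8))) ⟩
          ∣ (F 0ℚ - F (fromℕ 8)) + F (fromℕ 8) ∣   ≤⟨ ∣p+q∣≤∣p∣+∣q∣ (F 0ℚ - F (fromℕ 8)) (F (fromℕ 8)) ⟩
          ∣ F 0ℚ - F (fromℕ 8) ∣ + ∣ F (fromℕ 8) ∣ ≤⟨ +-mono-≤ (discreteMarkov m X (deg-rescale (fromℕ N ⁻¹) dE) F8≤X node-bound) F8≤X ⟩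
          X + X                                    ∎

  length≤64d² : ∀ {n} (p : Poly n) d → degree p ℕ.≤ d → ∀ x S → Unique S →
                1ℚ ≤ ∣ eval p x ∣ → NonemptyFlips (λ y → ∣ eval p y ∣ ≤ ⅓) x S → length S ℕ.≤ 64 ℕ.* (d ℕ.* d)
  length≤64d² p d deg≤d x S uS 1≤∣p∣ small with length S ℕ.≤? 64 ℕ.* (d ℕ.* d)
  ... | yes S≤64d² = S≤64d²
  ... | no S≰64d² with d
  ...   | zero = ⊥-elim (constant-impossible p x S 1≤∣p∣ small (ℕ.≰⇒> S≰64d²) (average-degree S uS x p 0 deg≤d))
  ...   | suc m = ⊥-elim (highDegree-impossible p x S 1≤∣p∣ small m (ℕ.≰⇒> S≰64d²) (average-degree S uS x p (suc m) deg≤d))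

module Sensitivity where

  open import Data.Nat using (ℕ; suc; _+_; _*_; _≤_; _⊔_; z≤n)
  open import Data.Nat.Properties using (⊔-lub; ≤-trans; *-monoʳ-≤; m≤m⊔n; m≤n⊔m)
  open import Data.Bool as B using (Bool; true; false; not; _xor_; T)
  import Data.Bool.Properties as B
  open import Data.Fin as Fin using (Fin)
  open import Data.List using (List; []; _∷_; length; foldr; map; allFin; filterᵇ)
  open import Data.List.Relation.Unary.All as All using (All; []; _∷_)
  open import Data.List.Relation.Unary.All.Properties using (all-filter)
  open import Data.List.Relation.Unary.Unique.Propositional using (Unique; []; _∷_)
  open import Data.List.Relation.Unary.Unique.Propositional.Properties using (allFin⁺; filter⁺)
  open import Data.Product using (_,_; proj₁; proj₂)
  open import Data.Sum using (inj₁; inj₂)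
  open import Relation.Nullary using (yes; no; contradiction)
  open import Relation.Nullary.Decidable using (T?)
  open import Relation.Binary.PropositionalEquality
  open CubeAverages using (Point; flipAt-≢; AllFlips; NonemptyFlips; AllFlips-map; NonemptyFlips-map)
  open ApproximationBound using (length≤64d²)

  ≤false⇒≡false : ∀ {b} → b B.≤ false → b ≡ false
  ≤false⇒≡false B.b≤b = refl

  true≤⇒≡true : ∀ {b} → true B.≤ b → b ≡ true
  true≤⇒≡true B.b≤b = refl

  module _ {n : ℕ} where

    sensitiveCoordinates : BoolFun n → Point n → List (Fin n)
    sensitiveCoordinates f x = filterᵇ (λ i → f (flipAt x i) xor f x) (allFin n)

    sensAt≡length : ∀ f x → sensAt f x ≡ length (sensitiveCoordinates f x)
    sensAt≡length f x = go (allFin n)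
      where
      go : ∀ L → foldr _+_ 0 (map (λ i → differs (f (flipAt x i)) (f x)) L) ≡ length (filterᵇ (λ i → f (flipAt x i) xor f x) L)
      go [] = refl
      go (i ∷ L) with f (flipAt x i) xor f x
      ... | true = cong suc (go L)
      ... | false = go L

    sensitiveCoordinates-unique : ∀ f x → Unique (sensitiveCoordinates f x)
    sensitiveCoordinates-unique f x = filter⁺ (λ i → T? (f (flipAt x i) xor f x)) (allFin⁺ n)

    sensitiveCoordinates-flip : ∀ f x → All (λ i → f (flipAt x i) ≡ not (f x)) (sensitiveCoordinates f x)
    sensitiveCoordinates-flip f x = All.map (xor⇒≡not _ _) (all-filter (λ i → T? (f (flipAt x i) xor f x)) (allFin n))
      where
      xor⇒≡not : ∀ a b → T (a xor b) → a ≡ not b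
      xor⇒≡not true false _ = refl
      xor⇒≡not false true _ = refl

    ≤ᶜ-refl : ∀ {x : Point n} → x ≤ᶜ x
    ≤ᶜ-refl i = B.≤-refl

    ≤ᶜ-trans : ∀ {x y z : Point n} → x ≤ᶜ y → y ≤ᶜ z → x ≤ᶜ z
    ≤ᶜ-trans x≤y y≤z i = B.≤-trans (x≤y i) (y≤z i)

    flipAt-preserves : ∀ (x : Point n) {i b S} → All (i ≢_) S → All (λ j → x j ≡ b) S → All (λ j → flipAt x i j ≡ b) S
    flipAt-preserves x [] [] = []
    flipAt-preserves x (i≢j ∷ i∉S) (xj≡b ∷ xS≡b) = trans (flipAt-≢ x i≢j) xj≡b ∷ flipAt-preserves x i∉S xS≡b

    flipAt-down : ∀ (x : Point n) {i} → x i ≡ true → flipAt x i ≤ᶜ x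
    flipAt-down x {i} xi≡true j with i Fin.≟ j
    ... | yes refl rewrite xi≡true = B.f≤t
    ... | no _ = B.b≤b

    flipAt-up : ∀ (x : Point n) {i} → x i ≡ false → x ≤ᶜ flipAt x i
    flipAt-up x {i} xi≡false j with i Fin.≟ j
    ... | yes refl rewrite xi≡false = B.f≤t
    ... | no _ = B.b≤b

    -- Flipping a coordinate that carries the bit b moves a point down along R (R = ≤ᶜ for b = 1, its converse for b = 0).
    module _ (b : Bool) (R : Point n → Point n → Set) (R-refl : ∀ {x} → R x x) (R-trans : ∀ {x y z} → R x y → R y z → R x z)
             (flipAt-R : ∀ x {i} → x i ≡ b → R (flipAt x i) x) where

      AllFlips-toward : ∀ S x {z} → R x z → All (λ j → x j ≡ b) S → Unique S → AllFlips (λ y → R y z) x S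
      AllFlips-toward [] x Rxz _ _ = Rxz
      AllFlips-toward (i ∷ S) x Rxz (xi≡b ∷ xS≡b) (i∉S ∷ uS) =
        AllFlips-toward S x Rxz xS≡b uS ,
        AllFlips-toward S (flipAt x i) (R-trans (flipAt-R x xi≡b) Rxz) (flipAt-preserves x i∉S xS≡b) uS

      NonemptyFlips-toward : ∀ {P : Point n → Set} S x → All (λ j → x j ≡ b) S → Unique S →
                             All (λ i → ∀ y → R y (flipAt x i) → P y) S → NonemptyFlips P x S
      NonemptyFlips-toward [] x _ _ _ = _
      NonemptyFlips-toward (i ∷ S) x (xi≡b ∷ xS≡b) (i∉S ∷ uS) (Pi ∷ PS) =
        NonemptyFlips-toward S x xS≡b uS PS ,
        AllFlips-map Pi (flipAt x i) S (AllFlips-toward S (flipAt x i) R-refl (flipAt-preserves x i∉S xS≡b) uS)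

    -- If g(x) = 1, the sensitive coordinates of x are 1-bits and lowering any of them lowers g to 0; dually if g(x) = 0.
    nondecreasing-flips : ∀ {g : BoolFun n} → NonDecreasing g → ∀ x S → Unique S →
                          All (λ i → g (flipAt x i) ≡ not (g x)) S → NonemptyFlips (λ y → g y ≡ not (g x)) x S
    nondecreasing-flips {g} mono x S uS flips with g x in gx≡
    ... | true = NonemptyFlips-toward true _≤ᶜ_ ≤ᶜ-refl ≤ᶜ-trans flipAt-down S x
                   (All.map (λ {i} → bit {i}) flips) uS (All.map (λ {i} → below {i}) flips)
      where
      bit : ∀ {i} → g (flipAt x i) ≡ false → x i ≡ true
      bit {i} gx′≡false with x i in xi≡
      ... | true = refl
      ... | false = contradiction (subst₂ B._≤_ gx≡ gx′≡false (mono x (flipAt x i) (flipAt-up x xi≡))) λ ()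
      below : ∀ {i} → g (flipAt x i) ≡ false → ∀ y → y ≤ᶜ flipAt x i → g y ≡ false
      below {i} gx′≡false y y≤x′ = ≤false⇒≡false (subst (g y B.≤_) gx′≡false (mono y (flipAt x i) y≤x′))
    ... | false = NonemptyFlips-toward false (λ u v → v ≤ᶜ u) ≤ᶜ-refl (λ v≤u w≤v → ≤ᶜ-trans w≤v v≤u) flipAt-up S x
                    (All.map (λ {i} → bit {i}) flips) uS (All.map (λ {i} → above {i}) flips)
      where
      bit : ∀ {i} → g (flipAt x i) ≡ true → x i ≡ false
      bit {i} gx′≡true with x i in xi≡
      ... | false = refl
      ... | true = contradiction (subst₂ B._≤_ gx′≡true gx≡ (mono (flipAt x i) x (flipAt-down x xi≡))) λ ()
      above : ∀ {i} → g (flipAt x i) ≡ true → ∀ y → flipAt x i ≤ᶜ y → g y ≡ true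
      above {i} gx′≡true y x′≤y = true≤⇒≡true (subst (B._≤ g y) gx′≡true (mono (flipAt x i) y x′≤y))

    monotone-flips : ∀ {f : BoolFun n} → Monotone f → ∀ x → NonemptyFlips (λ y → f y ≡ not (f x)) x (sensitiveCoordinates f x)
    monotone-flips {f} (inj₁ nondecreasing) x =
      nondecreasing-flips nondecreasing x _ (sensitiveCoordinates-unique f x) (sensitiveCoordinates-flip f x)
    monotone-flips {f} (inj₂ nonincreasing) x = NonemptyFlips-map (λ y → B.not-injective) x _
      (nondecreasing-flips {compl f} (λ y z y≤z → not-antimono (nonincreasing y z y≤z)) x _
        (sensitiveCoordinates-unique f x) (All.map (cong not) (sensitiveCoordinates-flip f x)))
      where
      not-antimono : ∀ {a b} → a B.≤ b → not b B.≤ not a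
      not-antimono B.f≤t = B.f≤t
      not-antimono B.b≤b = B.b≤b

    approximator-bound : ∀ {g : BoolFun n} {d x S} → NDegLe g d → g x ≡ true → Unique S →
                         NonemptyFlips (λ y → g y ≡ false) x S → length S ≤ 64 * (d * d)
    approximator-bound {d = d} {x} {S} (p , deg≤d , approximates) gx≡true uS flips =
      length≤64d² p d deg≤d x S uS (proj₂ (approximates x) gx≡true)
        (NonemptyFlips-map (λ y gy≡false → proj₁ (approximates y) gy≡false) x S flips)

    sensAt-bound : ∀ {f : BoolFun n} {d₁ d₂} → Monotone f → NDegLe f d₁ → NDegLe (compl f) d₂ →
                   ∀ x → sensAt f x ≤ 64 * ((d₁ * d₁) ⊔ (d₂ * d₂))
    sensAt-bound {f} {d₁} {d₂} mono A₁ A₂ x =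
      subst (_≤ 64 * ((d₁ * d₁) ⊔ (d₂ * d₂))) (sym (sensAt≡length f x)) (by-value (f x) refl)
      where
      S = sensitiveCoordinates f x
      uS = sensitiveCoordinates-unique f x
      flips-to : ∀ {b} → f x ≡ b → NonemptyFlips (λ y → f y ≡ not b) x S
      flips-to fx≡b = NonemptyFlips-map (λ y fy≡ → trans fy≡ (cong not fx≡b)) x S (monotone-flips mono x)
      by-value : ∀ b → f x ≡ b → length S ≤ 64 * ((d₁ * d₁) ⊔ (d₂ * d₂))
      by-value true fx≡true = ≤-trans (approximator-bound A₁ fx≡true uS (flips-to fx≡true))
                                      (*-monoʳ-≤ 64 (m≤m⊔n (d₁ * d₁) (d₂ * d₂)))
      by-value false fx≡false = ≤-trans (approximator-bound A₂ (cong not fx≡false) uS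
                                          (NonemptyFlips-map (λ y → cong not) x S (flips-to fx≡false)))
                                        (*-monoʳ-≤ 64 (m≤n⊔m (d₁ * d₁) (d₂ * d₂)))

  sensitivity≤ : ∀ {n} (f : BoolFun n) {k} → (∀ x → sensAt f x ≤ k) → sensitivity f ≤ k
  sensitivity≤ {n} f {k} sensAt≤k = go (cube n)
    where
    go : ∀ L → foldr _⊔_ 0 (map (sensAt f) L) ≤ k
    go [] = z≤n
    go (x ∷ L) = ⊔-lub (sensAt≤k x) (go L)

open import Data.Nat using (ℕ; _≤_; _*_; _⊔_; suc)
open import Data.Product using (∃; _,_)
open Sensitivity using (sensitivity≤; sensAt-bound)

lemma6 : ∃ λ (C : ℕ) → ∀ (n : ℕ) (f : BoolFun n) → Monotone f →
           ∀ (d₁ d₂ : ℕ) → NDegLe f d₁ → NDegLe (compl f) d₂ →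
           sensitivity f ≤ suc C * ((d₁ * d₁) ⊔ (d₂ * d₂))
lemma6 = 63 , λ n f monotone d₁ d₂ approx₁ approx₂ →
  sensitivity≤ f (sensAt-bound {d₁ = d₁} {d₂} monotone approx₁ approx₂)
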